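{- Let $\mathcal{M}$ be a minor-closed family of matroids having the bounded cocircuit property with constant $f$. Then for any $M\in\mathcal{M}$, either $\chi_M(\lambda)$ is identically zero or $\chi_M(\lambda)>0$ for all $\lambda>f$.
   Context: For a loopless matroid $M$ with ground set $E$ and rank function $r$, $\chi_M(\lambda)=\sum_{F\in L}\mu_M(\emptyset,F)\lambda^{r(E)-r(F)}$, where $L$ is the lattice of flats of $M$ and $\mu_M$ its Möbius function; if $M$ has a loop, $\chi_M(\lambda)=0$. A minor-closed family of matroids $\mathcal{M}$ has the bounded cocircuit property with constant $f$ if every simple matroid in $\mathcal{M}$ has a cocircuit of size at most $f$. -}

module Defs where

open import Level using (Level; _⊔_) renaming (suc to lsuc)
open import Data.Bool using (Bool; true; false; if_then_else_)
import Data.Bool as Bool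
open import Data.Nat using (ℕ; zero; suc; _∸_; _≤_; _<_)
import Data.Nat as ℕ
open import Data.Integer as ℤ using (ℤ; +_; -[1+_])
open import Data.Fin using (Fin)
import Data.Fin.Properties as FinP
open import Data.Fin.Subset using (Subset; inside; outside; ⊥; ⊤; ⁅_⁆; _∪_; _∩_; _⊆_; _∉_; ∁; ∣_∣)
open import Data.Fin.Subset.Properties using (_∈?_; _⊂?_)
open import Data.Vec using (Vec; []; _∷_; insertAt)
import Data.Vec.Properties as VecP
open import Data.List using (List; []; _∷_; _++_; map; filter)
open import Data.Product using (Σ; _×_)
open import Relation.Binary.PropositionalEquality using (_≡_; _≢_)
open import Relation.Nullary using (Dec; yes; no; ¬_)
open import Relation.Nullary.Decidable using (_→-dec_; ¬?)
import Data.Nat.Properties as ℕP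
open import Relation.Binary using (Rel; IsStrictTotalOrder)
open import Algebra.Bundles using (CommutativeRing)

record Matroid (n : ℕ) : Set where
  field
    rank     : Subset n → ℕ
    r-bound  : ∀ X → rank X ≤ ∣ X ∣
    r-mono   : ∀ {X Y} → X ⊆ Y → rank X ≤ rank Y
    r-submod : ∀ X Y → rank (X ∪ Y) ℕ.+ rank (X ∩ Y) ≤ rank X ℕ.+ rank Y

open Matroid public

module _ {n : ℕ} (M : Matroid n) where

  IsLoop : Fin n → Set
  IsLoop e = rank M ⁅ e ⁆ ≡ 0

  HasLoop : Set
  HasLoop = Σ (Fin n) IsLoop

  hasLoop? : Dec HasLoop
  hasLoop? = FinP.any? (λ e → rank M ⁅ e ⁆ ℕ.≟ 0)

  Simple : Set
  Simple = (∀ e → rank M ⁅ e ⁆ ≡ 1)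
         × (∀ e e′ → e ≢ e′ → rank M (⁅ e ⁆ ∪ ⁅ e′ ⁆) ≡ 2)

  IsFlat : Subset n → Set
  IsFlat X = ∀ e → e ∉ X → rank M X < rank M (X ∪ ⁅ e ⁆)

  flat? : (X : Subset n) → Dec (IsFlat X)
  flat? X = FinP.all? (λ e → ¬? (e ∈? X) →-dec (rank M X ℕP.<? rank M (X ∪ ⁅ e ⁆)))

  IsHyperplane : Subset n → Set
  IsHyperplane H = IsFlat H × (rank M H ℕ.+ 1 ≡ rank M ⊤)

  IsCocircuit : Subset n → Set
  IsCocircuit C = Σ (Subset n) λ H → IsHyperplane H × (C ≡ ∁ H)

-- Single-element deletion and contraction, as relations.
-- Elements of Fin n are identified with Fin (suc n) minus i via insertAt.

embed : ∀ {n} → Fin (suc n) → Subset n → Subset (suc n)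
embed i X = insertAt X i outside

IsDeletion : ∀ {n} → Matroid (suc n) → Fin (suc n) → Matroid n → Set
IsDeletion M i N = ∀ X → rank N X ≡ rank M (embed i X)

IsContraction : ∀ {n} → Matroid (suc n) → Fin (suc n) → Matroid n → Set
IsContraction M i N = ∀ X → rank N X ℕ.+ rank M ⁅ i ⁆ ≡ rank M (insertAt X i inside)

Family : (p : Level) → Set (lsuc p)
Family p = ∀ {n} → Matroid n → Set p

-- closed under single-element deletions and contractions (hence all minors)
MinorClosed : ∀ {p} → Family p → Set p
MinorClosed 𝓜 =
    (∀ {n} (M : Matroid (suc n)) i (N : Matroid n) → 𝓜 M → IsDeletion M i N → 𝓜 N)
  × (∀ {n} (M : Matroid (suc n)) i (N : Matroid n) → 𝓜 M → IsContraction M i N → 𝓜 N)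

BoundedCocircuit : ∀ {p} → Family p → ℕ → Set p
BoundedCocircuit 𝓜 f =
  ∀ {n} (M : Matroid (suc n)) → 𝓜 M → Simple M →
    Σ (Subset (suc n)) λ C → IsCocircuit M C × (∣ C ∣ ≤ f)

allSubsets : ∀ n → List (Subset n)
allSubsets zero    = [] ∷ []
allSubsets (suc n) = map (inside ∷_) (allSubsets n) ++ map (outside ∷_) (allSubsets n)

flats : ∀ {n} → Matroid n → List (Subset n)
flats M = filter (flat? M) (allSubsets _)

isEmpty? : ∀ {n} (X : Subset n) → Dec (X ≡ ⊥)
isEmpty? X = VecP.≡-dec Bool._≟_ X ⊥

sumℤ : List ℤ → ℤ
sumℤ []       = + 0
sumℤ (x ∷ xs) = x ℤ.+ sumℤ xs

-- μ(∅,∅) = 1,  μ(∅,F) = - Σ_{G flat, G ⊊ F} μ(∅,G)   (fuel = |F| suffices)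
möbiusFuel : ∀ {n} → Matroid n → ℕ → Subset n → ℤ
möbiusFuel M zero    F with isEmpty? F
... | yes _ = + 1
... | no  _ = + 0
möbiusFuel M (suc k) F with isEmpty? F
... | yes _ = + 1
... | no  _ = ℤ.- sumℤ (map (möbiusFuel M k) (filter (_⊂? F) (flats M)))

möbius : ∀ {n} → Matroid n → Subset n → ℤ
möbius M F = möbiusFuel M ∣ F ∣ F

χcoeff : ∀ {n} → Matroid n → ℕ → ℤ
χcoeff M k with hasLoop? M
... | yes _ = + 0
... | no  _ = sumℤ (map (möbius M) (filter (λ F → (rank M ⊤ ∸ rank M F) ℕ.≟ k) (flats M)))

IdenticallyZero : ∀ {n} → Matroid n → Set
IdenticallyZero M = ∀ k → χcoeff M k ≡ + 0

-- Ordered commutative rings (ℝ is one)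
record OrderedCommRing (c ℓ ℓ′ : Level) : Set (lsuc (c ⊔ ℓ ⊔ ℓ′)) where
  field
    commRing : CommutativeRing c ℓ
  open CommutativeRing commRing public
  field
    _<ᴿ_               : Rel Carrier ℓ′
    isStrictTotalOrder : IsStrictTotalOrder _≈_ _<ᴿ_
    +-mono-<           : ∀ {a b} c → a <ᴿ b → (a + c) <ᴿ (b + c)
    *-pos              : ∀ {a b} → 0# <ᴿ a → 0# <ᴿ b → 0# <ᴿ (a * b)

module _ {c ℓ ℓ′} (R : OrderedCommRing c ℓ ℓ′) where
  open OrderedCommRing R

  fromℕ : ℕ → Carrier
  fromℕ zero    = 0#
  fromℕ (suc k) = 1# + fromℕ k

  fromℤ : ℤ → Carrier
  fromℤ (+ k)      = fromℕ k
  fromℤ -[1+ k ]   = - fromℕ (suc k)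

  pow : Carrier → ℕ → Carrier
  pow x zero    = 1#
  pow x (suc k) = x * pow x k

  sumR : List Carrier → Carrier
  sumR []       = 0#
  sumR (x ∷ xs) = x + sumR xs

  χ : ∀ {n} → Matroid n → Carrier → Carrier
  χ M t with hasLoop? M
  ... | yes _ = 0#
  ... | no  _ = sumR (map (λ F → fromℤ (möbius M F) * pow t (rank M ⊤ ∸ rank M F)) (flats M))

-- Expand χ by Whitney's formula χ_N(λ) = Σ_{X ⊆ E} (-1)^|X| λ^(r(E) - r(X)), which follows from
-- Rota's crosscut formula μ(∅, F) = Σ_{cl X = F} (-1)^|X|, and more generally let w(N; S, C) be
-- the same sum for the minor (N / C) | S. Fix λ > f. By induction on the size of the ground set,
-- for every N in the family and disjoint S, C, w(N; S, C) ≥ 0, and w(N; S, C) > 0 if N / C has no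
-- loop in S. Deleting an element outside S ∪ C, or contracting an element of C, reduces this to a
-- smaller member of the family; so only S = E, C = ∅ is left, where a loop makes the sum vanish. If N has a
-- parallel pair {e, e′}, then χ_N = χ_{N \ e}, because e′ is a loop of N / e. Otherwise N is simple
-- and has a hyperplane H whose complement has at most f elements. Deleting the elements of E - H
-- one at a time, deletion–contraction together with the nonnegativity of the contracted terms
-- gives χ_N(λ) ≥ (λ - |E - H|) χ_{N | H}(λ) > 0.

module Submission where

open import Level using (Level)
open import Algebra.Bundles using (CommutativeMonoid)
import Algebra.Properties.AbelianGroup
open import Data.Bool using (Bool; true; false; _∨_; _∧_)
import Data.Bool as Bool
open import Data.Bool.Properties using (∨-identityʳ)
open import Data.Empty using (⊥-elim)
open import Data.Fin using (Fin; zero; suc; punchIn)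
import Data.Fin.Properties as FinP
open import Data.Fin.Subset using (Subset; inside; outside; ⊥; ⊤; ⁅_⁆; _∪_; _∩_; _⊆_; _∈_; _∉_; ∁; ∣_∣)
open import Data.Fin.Subset.Properties
open import Data.Integer as ℤ using (ℤ; +_; -[1+_])
import Data.Integer.Properties as ℤP
open import Data.List using (List; []; _∷_; _++_; map; filter)
import Data.List.Properties as ListP
open import Data.Nat using (ℕ; zero; suc; _≤_; _<_; _∸_; z≤n; s≤s)
import Data.Nat as ℕ
import Data.Nat.Properties as ℕP
open import Data.Nat.Solver using (module +-*-Solver)
open import Data.Product using (∃-syntax; _×_; _,_; proj₁; proj₂)
open import Data.Sum using (_⊎_; inj₁; inj₂)
open import Data.Vec using ([]; _∷_; insertAt; removeAt; lookup; tabulate; _[_]≔_; here; there)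
import Data.Vec.Properties as VecP
open VecP using (∷-injectiveʳ)
open import Relation.Binary.Bundles using (StrictPartialOrder)
open import Relation.Binary.Definitions using (tri<; tri≈; tri>)
import Relation.Binary.PropositionalEquality as ≡
open ≡ using (_≡_; _≢_)
open import Relation.Binary.Structures using (IsStrictTotalOrder)
open import Relation.Nullary using (Dec; yes; no; does; ¬_)
open import Relation.Nullary.Decidable using (_×-dec_; ¬?; dec-true; decidable-stable)
import Relation.Unary

open import Defs

_≟ˢ_ : ∀ {n} (X Y : Subset n) → Dec (X ≡ Y)
_≟ˢ_ = VecP.≡-dec Bool._≟_

module _ {n : ℕ} where

  ⊆⊎⊈ : (p q : Subset n) → q ⊆ p ⊎ ∃[ x ] x ∈ q × x ∉ p
  ⊆⊎⊈ p q with FinP.any? (λ x → (x ∈? q) ×-dec ¬? (x ∈? p))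
  ... | yes witness = inj₂ witness
  ... | no ¬witness = inj₁ q⊆p
    where
    q⊆p : q ⊆ p
    q⊆p {x} x∈q with x ∈? p
    ... | yes x∈p = x∈p
    ... | no  x∉p = ⊥-elim (¬witness (x , x∈q , x∉p))

  ∣p∣<∣q∣⇒q⊈p : (p q : Subset n) → ∣ p ∣ < ∣ q ∣ → ∃[ x ] x ∈ q × x ∉ p
  ∣p∣<∣q∣⇒q⊈p p q ∣p∣<∣q∣ with ⊆⊎⊈ p q
  ... | inj₁ q⊆p    = ⊥-elim (ℕP.<⇒≱ ∣p∣<∣q∣ (p⊆q⇒∣p∣≤∣q∣ q⊆p))
  ... | inj₂ witness = witness

  p⊆q∧∣q∣≤∣p∣⇒p≡q : (p q : Subset n) → p ⊆ q → ∣ q ∣ ≤ ∣ p ∣ → p ≡ q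
  p⊆q∧∣q∣≤∣p∣⇒p≡q p q p⊆q ∣q∣≤∣p∣ with ⊆⊎⊈ p q
  ... | inj₁ q⊆p               = ⊆-antisym p⊆q q⊆p
  ... | inj₂ (x , x∈q , x∉p) = ⊥-elim (ℕP.<⇒≱ (p⊂q⇒∣p∣<∣q∣ (p⊆q , x , x∈q , x∉p)) ∣q∣≤∣p∣)

  p≢⊤⇒∃∉ : (p : Subset n) → p ≢ ⊤ → ∃[ x ] x ∉ p
  p≢⊤⇒∃∉ p p≢⊤ with ⊆⊎⊈ p ⊤
  ... | inj₁ ⊤⊆p             = ⊥-elim (p≢⊤ (⊆-antisym ⊆⊤ ⊤⊆p))
  ... | inj₂ (x , _ , x∉p) = x , x∉p

  ∪-least : {p q r : Subset n} → p ⊆ r → q ⊆ r → p ∪ q ⊆ r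
  ∪-least {p} {q} p⊆r q⊆r x∈p∪q with x∈p∪q⁻ p q x∈p∪q
  ... | inj₁ x∈p = p⊆r x∈p
  ... | inj₂ x∈q = q⊆r x∈q

  ∪-monoˡ-⊆ : {p q : Subset n} (r : Subset n) → p ⊆ q → p ∪ r ⊆ q ∪ r
  ∪-monoˡ-⊆ {q = q} r p⊆q = ∪-least (λ x∈p → p⊆p∪q r (p⊆q x∈p)) (q⊆p∪q q r)

  ⁅x⁆⊆p : {x : Fin n} {p : Subset n} → x ∈ p → ⁅ x ⁆ ⊆ p
  ⁅x⁆⊆p {x} {p} x∈p y∈⁅x⁆ = ≡.subst (_∈ p) (≡.sym (x∈⁅y⁆⇒x≡y x y∈⁅x⁆)) x∈p

insertAt-∪ : ∀ {n} (p q : Subset n) i a b →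
             insertAt p i a ∪ insertAt q i b ≡ insertAt (p ∪ q) i (a ∨ b)
insertAt-∪ p       q       zero    a b = ≡.refl
insertAt-∪ (c ∷ p) (d ∷ q) (suc i) a b = ≡.cong ((c ∨ d) ∷_) (insertAt-∪ p q i a b)

insertAt-∩ : ∀ {n} (p q : Subset n) i a b →
             insertAt p i a ∩ insertAt q i b ≡ insertAt (p ∩ q) i (a ∧ b)
insertAt-∩ p       q       zero    a b = ≡.refl
insertAt-∩ (c ∷ p) (d ∷ q) (suc i) a b = ≡.cong ((c ∧ d) ∷_) (insertAt-∩ p q i a b)

insertAt-⊥-outside : ∀ {n} i → insertAt (⊥ {n}) i outside ≡ ⊥
insertAt-⊥-outside          zero    = ≡.refl
insertAt-⊥-outside {suc n} (suc i) = ≡.cong (outside ∷_) (insertAt-⊥-outside i)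

insertAt-⊥-inside : ∀ {n} i → insertAt (⊥ {n}) i inside ≡ ⁅ i ⁆
insertAt-⊥-inside          zero    = ≡.refl
insertAt-⊥-inside {suc n} (suc i) = ≡.cong (outside ∷_) (insertAt-⊥-inside i)

insertAt-⁅⁆ : ∀ {n} (j : Fin n) i → insertAt ⁅ j ⁆ i outside ≡ ⁅ punchIn i j ⁆
insertAt-⁅⁆ j       zero    = ≡.refl
insertAt-⁅⁆ zero    (suc i) = ≡.cong (inside ∷_) (insertAt-⊥-outside i)
insertAt-⁅⁆ (suc j) (suc i) = ≡.cong (outside ∷_) (insertAt-⁅⁆ j i)

insertAt-∪⁅⁆ : ∀ {n} (p : Subset n) i → insertAt p i outside ∪ ⁅ i ⁆ ≡ insertAt p i inside
insertAt-∪⁅⁆ p i = begin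
  insertAt p i outside ∪ ⁅ i ⁆            ≡⟨ ≡.cong (insertAt p i outside ∪_) (insertAt-⊥-inside i) ⟨
  insertAt p i outside ∪ insertAt ⊥ i inside ≡⟨ insertAt-∪ p ⊥ i outside inside ⟩
  insertAt (p ∪ ⊥) i inside               ≡⟨ ≡.cong (λ q → insertAt q i inside) (∪-identityʳ p) ⟩
  insertAt p i inside ∎
  where open ≡.≡-Reasoning

insertAt-mono-⊆ : ∀ {n} {p q : Subset n} i b → p ⊆ q → insertAt p i b ⊆ insertAt q i b
insertAt-mono-⊆                         zero    b p⊆q = s⊆s p⊆q
insertAt-mono-⊆ {p = c ∷ p} {d ∷ q} (suc i) b p⊆q = c∷⊆d∷
  where
  c∷⊆d∷ : c ∷ insertAt p i b ⊆ d ∷ insertAt q i b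
  c∷⊆d∷ here with p⊆q (here {x = c} {xs = p})
  ... | here = here
  c∷⊆d∷ (there x∈) = there (insertAt-mono-⊆ i b (drop-∷-⊆ p⊆q) x∈)

insertAt-outside⊆inside : ∀ {n} (p : Subset n) i → insertAt p i outside ⊆ insertAt p i inside
insertAt-outside⊆inside p       zero    = out⊆ ⊆-refl
insertAt-outside⊆inside (c ∷ p) (suc i) = s⊆s (insertAt-outside⊆inside p i)

x∈p⇒punchIn∈insertAt : ∀ {n} {p : Subset n} {x} i b → x ∈ p → punchIn i x ∈ insertAt p i b
x∈p⇒punchIn∈insertAt                     zero    b x∈p         = there x∈p
x∈p⇒punchIn∈insertAt {p = c ∷ p} {zero}  (suc i) b here        = here
x∈p⇒punchIn∈insertAt {p = c ∷ p} {suc x} (suc i) b (there x∈p) =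
  there (x∈p⇒punchIn∈insertAt i b x∈p)

∣insertAt-outside∣ : ∀ {n} (p : Subset n) i → ∣ insertAt p i outside ∣ ≡ ∣ p ∣
∣insertAt-outside∣ p             zero    = ≡.refl
∣insertAt-outside∣ (inside ∷ p)  (suc i) = ≡.cong suc (∣insertAt-outside∣ p i)
∣insertAt-outside∣ (outside ∷ p) (suc i) = ∣insertAt-outside∣ p i

∣insertAt-inside∣ : ∀ {n} (p : Subset n) i → ∣ insertAt p i inside ∣ ≡ suc ∣ p ∣
∣insertAt-inside∣ p             zero    = ≡.refl
∣insertAt-inside∣ (inside ∷ p)  (suc i) = ≡.cong suc (∣insertAt-inside∣ p i)
∣insertAt-inside∣ (outside ∷ p) (suc i) = ∣insertAt-inside∣ p i

insertAt-removeAt-≔ : ∀ {n} (p : Subset (suc n)) i (b : Bool) →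
                      insertAt (removeAt p i) i b ≡ p [ i ]≔ b
insertAt-removeAt-≔ (c ∷ p)           zero    b = ≡.refl
insertAt-removeAt-≔ (c ∷ p@(_ ∷ _)) (suc i) b = ≡.cong (c ∷_) (insertAt-removeAt-≔ p i b)

module _ {n : ℕ} where

  x∈p⇒p[x]≔inside≡p : {x : Fin n} {p : Subset n} → x ∈ p → p [ x ]≔ inside ≡ p
  x∈p⇒p[x]≔inside≡p {x} {p} x∈p =
    ≡.trans (≡.cong (p [ x ]≔_) (≡.sym (VecP.[]=⇒lookup x∈p))) (VecP.[]≔-lookup p x)

  x∉p⇒p[x]≔outside≡p : {x : Fin n} {p : Subset n} → x ∉ p → p [ x ]≔ outside ≡ p
  x∉p⇒p[x]≔outside≡p {x} {p} x∉p =
    ≡.trans (≡.cong (p [ x ]≔_) (≡.sym lookup≡outside)) (VecP.[]≔-lookup p x)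
    where
    lookup≡outside : lookup p x ≡ outside
    lookup≡outside with lookup p x in eq
    ... | inside  = ⊥-elim (x∉p (VecP.lookup⇒[]= x p eq))
    ... | outside = ≡.refl

  x∉p[x]≔outside : (p : Subset n) (x : Fin n) → x ∉ p [ x ]≔ outside
  x∉p[x]≔outside p x x∈ with ≡.trans (≡.sym (VecP.[]=⇒lookup x∈)) (VecP.lookup∘update x p outside)
  ... | ()

  y∈p⇒y∈p[x]≔b : (p : Subset n) {x y : Fin n} (b : Bool) → y ≢ x → y ∈ p → y ∈ p [ x ]≔ b
  y∈p⇒y∈p[x]≔b p {x} {y} b y≢x y∈p = VecP.[]≔-minimal p y x y≢x y∈p

  y∈p[x]≔b⇒y∈p : (p : Subset n) {x y : Fin n} (b : Bool) → y ≢ x → y ∈ p [ x ]≔ b → y ∈ p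
  y∈p[x]≔b⇒y∈p p {x} {y} b y≢x y∈ =
    VecP.lookup⇒[]= y p (≡.trans (≡.sym (VecP.lookup∘update′ y≢x p b)) (VecP.[]=⇒lookup y∈))

  p[x]≔outside⊆p : (p : Subset n) (x : Fin n) → p [ x ]≔ outside ⊆ p
  p[x]≔outside⊆p p x {y} y∈ with y FinP.≟ x
  ... | yes ≡.refl = ⊥-elim (x∉p[x]≔outside p x y∈)
  ... | no  y≢x    = y∈p[x]≔b⇒y∈p p outside y≢x y∈

module _ {n : ℕ} where

  ⊥[x]≔inside≡⁅x⁆ : (x : Fin (suc n)) → ⊥ [ x ]≔ inside ≡ ⁅ x ⁆
  ⊥[x]≔inside≡⁅x⁆ x = ≡.trans (≡.sym (insertAt-removeAt-≔ ⊥ x inside))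
    (≡.trans (≡.cong (λ q → insertAt q x inside) (removeAt-⊥ x)) (insertAt-⊥-inside x))
    where
    removeAt-⊥ : ∀ {m} (i : Fin (suc m)) → removeAt (⊥ {suc m}) i ≡ ⊥
    removeAt-⊥ i = ≡.trans (≡.cong (λ q → removeAt q i) (≡.sym (insertAt-⊥-outside i)))
                           (VecP.removeAt-insertAt ⊥ i outside)

  p[x]≔outside∪⁅x⁆ : (p : Subset (suc n)) (x : Fin (suc n)) → (p [ x ]≔ outside) ∪ ⁅ x ⁆ ≡ p [ x ]≔ inside
  p[x]≔outside∪⁅x⁆ p x = begin
    (p [ x ]≔ outside) ∪ ⁅ x ⁆                ≡⟨ ≡.cong (_∪ ⁅ x ⁆) (insertAt-removeAt-≔ p x outside) ⟨
    insertAt (removeAt p x) x outside ∪ ⁅ x ⁆ ≡⟨ insertAt-∪⁅⁆ (removeAt p x) x ⟩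
    insertAt (removeAt p x) x inside         ≡⟨ insertAt-removeAt-≔ p x inside ⟩
    p [ x ]≔ inside ∎
    where open ≡.≡-Reasoning

∣p∣≡1+∣p[x]≔outside∣ : ∀ {n} {x : Fin n} {p : Subset n} → x ∈ p → ∣ p ∣ ≡ suc ∣ p [ x ]≔ outside ∣
∣p∣≡1+∣p[x]≔outside∣ {suc n} {x} {p} x∈p = begin
  ∣ p ∣                                 ≡⟨ ≡.cong ∣_∣ (x∈p⇒p[x]≔inside≡p x∈p) ⟨
  ∣ p [ x ]≔ inside ∣                  ≡⟨ ≡.cong ∣_∣ (insertAt-removeAt-≔ p x inside) ⟨
  ∣ insertAt (removeAt p x) x inside ∣  ≡⟨ ∣insertAt-inside∣ (removeAt p x) x ⟩
  suc ∣ removeAt p x ∣                  ≡⟨ ≡.cong suc (∣insertAt-outside∣ (removeAt p x) x) ⟨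
  suc ∣ insertAt (removeAt p x) x outside ∣ ≡⟨ ≡.cong (λ q → suc ∣ q ∣) (insertAt-removeAt-≔ p x outside) ⟩
  suc ∣ p [ x ]≔ outside ∣ ∎
  where open ≡.≡-Reasoning

insertAt-∪⁅punchIn⁆ : ∀ {n} (C : Subset n) i b y →
                      insertAt C i b ∪ ⁅ punchIn i y ⁆ ≡ insertAt (C ∪ ⁅ y ⁆) i b
insertAt-∪⁅punchIn⁆ C i b y = begin
  insertAt C i b ∪ ⁅ punchIn i y ⁆              ≡⟨ ≡.cong (insertAt C i b ∪_) (insertAt-⁅⁆ y i) ⟨
  insertAt C i b ∪ insertAt ⁅ y ⁆ i outside     ≡⟨ insertAt-∪ C ⁅ y ⁆ i b outside ⟩
  insertAt (C ∪ ⁅ y ⁆) i (b ∨ false)            ≡⟨ ≡.cong (insertAt (C ∪ ⁅ y ⁆) i) (∨-identityʳ b) ⟩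
  insertAt (C ∪ ⁅ y ⁆) i b ∎
  where open ≡.≡-Reasoning

∣p∣+∣∁p∣≡n : ∀ {n} (p : Subset n) → ∣ p ∣ ℕ.+ ∣ ∁ p ∣ ≡ n
∣p∣+∣∁p∣≡n []            = ≡.refl
∣p∣+∣∁p∣≡n (inside ∷ p)  = ≡.cong suc (∣p∣+∣∁p∣≡n p)
∣p∣+∣∁p∣≡n (outside ∷ p) = ≡.trans (ℕP.+-suc ∣ p ∣ ∣ ∁ p ∣) (≡.cong suc (∣p∣+∣∁p∣≡n p))

record ExtraElement {n} (H S : Subset n) (k : ℕ) : Set where
  field
    x     : Fin n
    x∈S   : x ∈ S
    x∉H   : x ∉ H
    H⊆S-x : H ⊆ S [ x ]≔ outside
    ∣S-x∣ : ∣ S [ x ]≔ outside ∣ ≡ ∣ H ∣ ℕ.+ k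

extraElement : ∀ {n} {H S : Subset n} k → H ⊆ S → ∣ S ∣ ≡ ∣ H ∣ ℕ.+ suc k → ExtraElement H S k
extraElement {H = H} {S} k H⊆S ∣S∣ with ∣p∣<∣q∣⇒q⊈p H S (≡.subst (∣ H ∣ <_) (≡.sym ∣S∣) (ℕP.m<m+n ∣ H ∣ (s≤s z≤n)))
... | x , x∈S , x∉H = record
  { x     = x
  ; x∈S   = x∈S
  ; x∉H   = x∉H
  ; H⊆S-x = λ {y} y∈H → y∈p⇒y∈p[x]≔b S outside (λ y≡x → x∉H (≡.subst (_∈ H) y≡x y∈H)) (H⊆S y∈H)
  ; ∣S-x∣ = ℕP.suc-injective (≡.trans (≡.sym (∣p∣≡1+∣p[x]≔outside∣ x∈S)) (≡.trans ∣S∣ (ℕP.+-suc ∣ H ∣ k)))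
  }

-- Sums over the subsets of a subset

module SubsetSum {c ℓ} (M : CommutativeMonoid c ℓ) where
  open CommutativeMonoid M renaming (Carrier to A)
  open import Algebra.Properties.CommutativeSemigroup commutativeSemigroup using (interchange)
  open import Relation.Binary.Reasoning.Setoid setoid

  ∑⊆ : ∀ {n} → Subset n → (Subset n → A) → A
  ∑⊆ []            h = h []
  ∑⊆ (inside ∷ S)  h = ∑⊆ S (λ X → h (inside ∷ X)) ∙ ∑⊆ S (λ X → h (outside ∷ X))
  ∑⊆ (outside ∷ S) h = ∑⊆ S (λ X → h (outside ∷ X))

  sumList : List A → A
  sumList []       = ε
  sumList (x ∷ xs) = x ∙ sumList xs

  when : ∀ {p} {P : Set p} → Dec P → A → A
  when (yes _) v = v
  when (no _)  v = ε

  ∑⊆-cong : ∀ {n} (S : Subset n) {h g : Subset n → A} →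
            (∀ X → X ⊆ S → h X ≈ g X) → ∑⊆ S h ≈ ∑⊆ S g
  ∑⊆-cong []            eq = eq [] (λ ())
  ∑⊆-cong (inside ∷ S)  eq =
    ∙-cong (∑⊆-cong S (λ X X⊆S → eq _ (in⊆in X⊆S))) (∑⊆-cong S (λ X X⊆S → eq _ (out⊆ X⊆S)))
  ∑⊆-cong (outside ∷ S) eq = ∑⊆-cong S (λ X X⊆S → eq _ (out⊆ X⊆S))

  ∑⊆-∙ : ∀ {n} (S : Subset n) (h g : Subset n → A) →
         ∑⊆ S (λ X → h X ∙ g X) ≈ ∑⊆ S h ∙ ∑⊆ S g
  ∑⊆-∙ []            h g = refl
  ∑⊆-∙ (inside ∷ S)  h g = trans (∙-cong (∑⊆-∙ S _ _) (∑⊆-∙ S _ _)) (interchange _ _ _ _)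
  ∑⊆-∙ (outside ∷ S) h g = ∑⊆-∙ S _ _

  ∑⊆-ε : ∀ {n} (S : Subset n) (h : Subset n → A) → (∀ X → h X ≈ ε) → ∑⊆ S h ≈ ε
  ∑⊆-ε []            h h≈ε = h≈ε []
  ∑⊆-ε (inside ∷ S)  h h≈ε =
    trans (∙-cong (∑⊆-ε S _ (λ _ → h≈ε _)) (∑⊆-ε S _ (λ _ → h≈ε _))) (identityˡ ε)
  ∑⊆-ε (outside ∷ S) h h≈ε = ∑⊆-ε S _ (λ _ → h≈ε _)

  ∑⊆-comm : ∀ {n m} (S : Subset n) (T : Subset m) (g : Subset n → Subset m → A) →
            ∑⊆ S (λ X → ∑⊆ T (g X)) ≈ ∑⊆ T (λ Y → ∑⊆ S (λ X → g X Y))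
  ∑⊆-comm []            T g = refl
  ∑⊆-comm (inside ∷ S)  T g = trans (∙-cong (∑⊆-comm S T _) (∑⊆-comm S T _)) (sym (∑⊆-∙ T _ _))
  ∑⊆-comm (outside ∷ S) T g = ∑⊆-comm S T _

  ∑⊆-single : ∀ {n} (S Y : Subset n) (h : Subset n → A) → Y ⊆ S →
              (∀ X → X ≢ Y → h X ≈ ε) → ∑⊆ S h ≈ h Y
  ∑⊆-single []            []            h _    _   = refl
  ∑⊆-single (inside ∷ S)  (inside ∷ Y)  h Y⊆S off = begin
    ∑⊆ S (λ X → h (inside ∷ X)) ∙ ∑⊆ S (λ X → h (outside ∷ X))
      ≈⟨ ∙-cong (∑⊆-single S Y _ (drop-∷-⊆ Y⊆S) (λ X X≢Y → off _ (λ e → X≢Y (∷-injectiveʳ e))))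
                (∑⊆-ε S _ (λ X → off _ (λ ()))) ⟩
    h (inside ∷ Y) ∙ ε ≈⟨ identityʳ _ ⟩
    h (inside ∷ Y) ∎
  ∑⊆-single (inside ∷ S)  (outside ∷ Y) h Y⊆S off = begin
    ∑⊆ S (λ X → h (inside ∷ X)) ∙ ∑⊆ S (λ X → h (outside ∷ X))
      ≈⟨ ∙-cong (∑⊆-ε S _ (λ X → off _ (λ ())))
                (∑⊆-single S Y _ (drop-∷-⊆ Y⊆S) (λ X X≢Y → off _ (λ e → X≢Y (∷-injectiveʳ e)))) ⟩
    ε ∙ h (outside ∷ Y) ≈⟨ identityˡ _ ⟩
    h (outside ∷ Y) ∎
  ∑⊆-single (outside ∷ S) (inside ∷ Y)  h Y⊆S off with Y⊆S here
  ... | ()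
  ∑⊆-single (outside ∷ S) (outside ∷ Y) h Y⊆S off =
    ∑⊆-single S Y _ (drop-∷-⊆ Y⊆S) (λ X X≢Y → off _ (λ e → X≢Y (∷-injectiveʳ e)))

  ∑⊆-insertAt-outside : ∀ {n} (S : Subset n) (i : Fin (suc n)) (h : Subset (suc n) → A) →
    ∑⊆ (insertAt S i outside) h ≈ ∑⊆ S (λ X → h (insertAt X i outside))
  ∑⊆-insertAt-outside S             zero    h = refl
  ∑⊆-insertAt-outside (inside ∷ S)  (suc i) h =
    ∙-cong (∑⊆-insertAt-outside S i _) (∑⊆-insertAt-outside S i _)
  ∑⊆-insertAt-outside (outside ∷ S) (suc i) h = ∑⊆-insertAt-outside S i _

  ∑⊆-insertAt-inside : ∀ {n} (S : Subset n) (i : Fin (suc n)) (h : Subset (suc n) → A) →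
    ∑⊆ (insertAt S i inside) h ≈
      ∑⊆ S (λ X → h (insertAt X i inside)) ∙ ∑⊆ S (λ X → h (insertAt X i outside))
  ∑⊆-insertAt-inside S             zero    h = refl
  ∑⊆-insertAt-inside (inside ∷ S)  (suc i) h =
    trans (∙-cong (∑⊆-insertAt-inside S i _) (∑⊆-insertAt-inside S i _)) (interchange _ _ _ _)
  ∑⊆-insertAt-inside (outside ∷ S) (suc i) h = ∑⊆-insertAt-inside S i _

  sumList-++ : ∀ xs ys → sumList (xs ++ ys) ≈ sumList xs ∙ sumList ys
  sumList-++ []       ys = sym (identityˡ _)
  sumList-++ (x ∷ xs) ys = trans (∙-congˡ (sumList-++ xs ys)) (sym (assoc _ _ _))

  sumList-filter : ∀ {p} {B : Set} {P : B → Set p} (P? : Relation.Unary.Decidable P) (h : B → A) xs →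
    sumList (map h (filter P? xs)) ≈ sumList (map (λ x → when (P? x) (h x)) xs)
  sumList-filter P? h []       = refl
  sumList-filter P? h (x ∷ xs) with P? x
  ... | yes _ = ∙-congˡ (sumList-filter P? h xs)
  ... | no  _ = trans (sumList-filter P? h xs) (sym (identityˡ _))

  sumList-allSubsets : ∀ n (h : Subset n → A) → sumList (map h (allSubsets n)) ≈ ∑⊆ ⊤ h
  sumList-allSubsets zero    h = identityʳ _
  sumList-allSubsets (suc n) h = begin
    sumList (map h (map (inside ∷_) L ++ map (outside ∷_) L))
      ≡⟨ ≡.cong sumList (ListP.map-++ h (map (inside ∷_) L) (map (outside ∷_) L)) ⟩
    sumList (map h (map (inside ∷_) L) ++ map h (map (outside ∷_) L))
      ≈⟨ sumList-++ (map h (map (inside ∷_) L)) (map h (map (outside ∷_) L)) ⟩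
    sumList (map h (map (inside ∷_) L)) ∙ sumList (map h (map (outside ∷_) L))
      ≡⟨ ≡.cong₂ (λ a b → sumList a ∙ sumList b) (≡.sym (ListP.map-∘ L)) (≡.sym (ListP.map-∘ L)) ⟩
    sumList (map (λ X → h (inside ∷ X)) L) ∙ sumList (map (λ X → h (outside ∷ X)) L)
      ≈⟨ ∙-cong (sumList-allSubsets n _) (sumList-allSubsets n _) ⟩
    ∑⊆ ⊤ (λ X → h (inside ∷ X)) ∙ ∑⊆ ⊤ (λ X → h (outside ∷ X)) ∎
    where L = allSubsets n

  when-yes : ∀ {p} {P : Set p} (P? : Dec P) {v} → P → when P? v ≈ v
  when-yes (yes _) _  = refl
  when-yes (no ¬p) p = ⊥-elim (¬p p)

  when-no : ∀ {p} {P : Set p} (P? : Dec P) {v} → ¬ P → when P? v ≈ ε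
  when-no (yes p) ¬p = ⊥-elim (¬p p)
  when-no (no _)  _  = refl

  when-ε : ∀ {p} {P : Set p} (P? : Dec P) → when P? ε ≈ ε
  when-ε (yes _) = refl
  when-ε (no _)  = refl

  when-∙ : ∀ {p} {P : Set p} (P? : Dec P) a b → when P? (a ∙ b) ≈ when P? a ∙ when P? b
  when-∙ (yes _) a b = refl
  when-∙ (no _)  a b = sym (identityˡ ε)

  when-⇔ : ∀ {p q} {P : Set p} {Q : Set q} (P? : Dec P) (Q? : Dec Q) {v} →
           (P → Q) → (Q → P) → when P? v ≈ when Q? v
  when-⇔ (yes _) (yes _) _   _   = refl
  when-⇔ (yes p) (no ¬q) p→q _   = ⊥-elim (¬q (p→q p))
  when-⇔ (no ¬p) (yes q) _   q→p = ⊥-elim (¬p (q→p q))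
  when-⇔ (no _)  (no _)  _   _   = refl

  when-cong : ∀ {p} {P : Set p} (P? : Dec P) {v w} → (P → v ≈ w) → when P? v ≈ when P? w
  when-cong (yes p) v≈w = v≈w p
  when-cong (no _)  _   = refl

  when-∑⊆ : ∀ {p} {P : Set p} (P? : Dec P) {n} (S : Subset n) h →
            when P? (∑⊆ S h) ≈ ∑⊆ S (λ X → when P? (h X))
  when-∑⊆ (yes _) S h = refl
  when-∑⊆ (no _)  S h = sym (∑⊆-ε S _ (λ _ → refl))

  when-comm : ∀ {p q} {P : Set p} {Q : Set q} (P? : Dec P) (Q? : Dec Q) {v} →
              when P? (when Q? v) ≈ when Q? (when P? v)
  when-comm (yes _) (yes _) = refl
  when-comm (yes _) (no _)  = refl
  when-comm (no _)  (yes _) = refl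
  when-comm (no _)  (no _)  = refl

  ∑⊆-fibres : ∀ {n m p} {P : Subset m → Set p} (P? : Relation.Unary.Decidable P)
              (g : Subset n → Subset m) → (∀ X → P (g X)) → (h : Subset n → Subset m → A) →
              ∑⊆ ⊤ (λ F → when (P? F) (∑⊆ ⊤ (λ X → when (g X ≟ˢ F) (h X F)))) ≈ ∑⊆ ⊤ (λ X → h X (g X))
  ∑⊆-fibres {n} {m} P? g P-g h = begin
    ∑⊆ ⊤ (λ F → when (P? F) (∑⊆ ⊤ (λ X → when (g X ≟ˢ F) (h X F))))
      ≈⟨ ∑⊆-cong (⊤ {m}) (λ F _ → when-∑⊆ (P? F) (⊤ {n}) _) ⟩
    ∑⊆ ⊤ (λ F → ∑⊆ ⊤ (λ X → when (P? F) (when (g X ≟ˢ F) (h X F)))) ≈⟨ ∑⊆-comm (⊤ {m}) (⊤ {n}) _ ⟩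
    ∑⊆ ⊤ (λ X → ∑⊆ ⊤ (λ F → when (P? F) (when (g X ≟ˢ F) (h X F))))
      ≈⟨ ∑⊆-cong (⊤ {n}) (λ X _ → ∑⊆-single (⊤ {m}) (g X) _ ⊆⊤ (λ F F≢gX →
           trans (when-cong (P? F) (λ _ → when-no (g X ≟ˢ F) (λ gX≡F → F≢gX (≡.sym gX≡F)))) (when-ε (P? F)))) ⟩
    ∑⊆ ⊤ (λ X → when (P? (g X)) (when (g X ≟ˢ g X) (h X (g X))))
      ≈⟨ ∑⊆-cong (⊤ {n}) (λ X _ → trans (when-yes (P? (g X)) (P-g X)) (when-yes (g X ≟ˢ g X) ≡.refl)) ⟩
    ∑⊆ ⊤ (λ X → h X (g X)) ∎

  ∑⊆-⊤-when-⊆ : ∀ {n} (F : Subset n) (h : Subset n → A) →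
                 ∑⊆ ⊤ (λ X → when (X ⊆? F) (h X)) ≈ ∑⊆ F h
  ∑⊆-⊤-when-⊆ []           h = when-yes ([] ⊆? []) (λ ())
  ∑⊆-⊤-when-⊆ (inside ∷ F)  h = ∙-cong
    (trans (∑⊆-cong ⊤ (λ X _ → when-⇔ (inside ∷ X ⊆? inside ∷ F) (X ⊆? F) drop-∷-⊆ in⊆in))
           (∑⊆-⊤-when-⊆ F _))
    (trans (∑⊆-cong ⊤ (λ X _ → when-⇔ (outside ∷ X ⊆? inside ∷ F) (X ⊆? F) drop-∷-⊆ out⊆))
           (∑⊆-⊤-when-⊆ F _))
  ∑⊆-⊤-when-⊆ (outside ∷ F) h = begin
    ∑⊆ ⊤ (λ X → when (inside ∷ X ⊆? outside ∷ F) (h (inside ∷ X)))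
      ∙ ∑⊆ ⊤ (λ X → when (outside ∷ X ⊆? outside ∷ F) (h (outside ∷ X)))
      ≈⟨ ∙-cong (∑⊆-ε ⊤ _ (λ X → when-no (inside ∷ X ⊆? outside ∷ F) {h (inside ∷ X)} (λ sub → 0∉ (sub here))))
                (∑⊆-cong ⊤ (λ X _ → when-⇔ (outside ∷ X ⊆? outside ∷ F) (X ⊆? F) drop-∷-⊆ out⊆)) ⟩
    ε ∙ ∑⊆ ⊤ (λ X → when (X ⊆? F) (h (outside ∷ X))) ≈⟨ identityˡ _ ⟩
    ∑⊆ ⊤ (λ X → when (X ⊆? F) (h (outside ∷ X))) ≈⟨ ∑⊆-⊤-when-⊆ F _ ⟩
    ∑⊆ F (λ X → h (outside ∷ X)) ∎
    where
    0∉ : ∀ {k} {V : Subset k} → zero ∉ outside ∷ V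
    0∉ ()

module SubsetSumHomomorphism
  {c₁ ℓ₁ c₂ ℓ₂} (M₁ : CommutativeMonoid c₁ ℓ₁) (M₂ : CommutativeMonoid c₂ ℓ₂)
  (φ : CommutativeMonoid.Carrier M₁ → CommutativeMonoid.Carrier M₂)
  (φ-cong : ∀ {a b} → CommutativeMonoid._≈_ M₁ a b → CommutativeMonoid._≈_ M₂ (φ a) (φ b))
  (φ-∙ : ∀ a b → CommutativeMonoid._≈_ M₂ (φ (CommutativeMonoid._∙_ M₁ a b))
                                           (CommutativeMonoid._∙_ M₂ (φ a) (φ b)))
  where
  open CommutativeMonoid M₂
  open SubsetSum M₁ using () renaming (∑⊆ to ∑⊆₁)
  open SubsetSum M₂ using () renaming (∑⊆ to ∑⊆₂)

  ∑⊆-hom : ∀ {n} (S : Subset n) h → φ (∑⊆₁ S h) ≈ ∑⊆₂ S (λ X → φ (h X))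
  ∑⊆-hom []            h = refl
  ∑⊆-hom (inside ∷ S)  h = trans (φ-∙ _ _) (∙-cong (∑⊆-hom S _) (∑⊆-hom S _))
  ∑⊆-hom (outside ∷ S) h = ∑⊆-hom S _

∸-mono-+-≤ : ∀ {k a b c d} → k ≤ a → k ≤ b → k ≤ c → k ≤ d → a ℕ.+ b ≤ c ℕ.+ d →
             (a ∸ k) ℕ.+ (b ∸ k) ≤ (c ∸ k) ℕ.+ (d ∸ k)
∸-mono-+-≤ {k} {a} {b} {c} {d} k≤a k≤b k≤c k≤d a+b≤c+d = ℕP.+-cancelʳ-≤ (k ℕ.+ k) _ _ (begin
  (a ∸ k) ℕ.+ (b ∸ k) ℕ.+ (k ℕ.+ k)     ≡⟨ shuffle (a ∸ k) (b ∸ k) ⟩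
  ((a ∸ k) ℕ.+ k) ℕ.+ ((b ∸ k) ℕ.+ k)   ≡⟨ ≡.cong₂ ℕ._+_ (ℕP.m∸n+n≡m k≤a) (ℕP.m∸n+n≡m k≤b) ⟩
  a ℕ.+ b                               ≤⟨ a+b≤c+d ⟩
  c ℕ.+ d                               ≡⟨ ≡.cong₂ ℕ._+_ (ℕP.m∸n+n≡m k≤c) (ℕP.m∸n+n≡m k≤d) ⟨
  ((c ∸ k) ℕ.+ k) ℕ.+ ((d ∸ k) ℕ.+ k)   ≡⟨ shuffle (c ∸ k) (d ∸ k) ⟨
  (c ∸ k) ℕ.+ (d ∸ k) ℕ.+ (k ℕ.+ k) ∎)
  where
  open ℕP.≤-Reasoning
  shuffle : ∀ p q → p ℕ.+ q ℕ.+ (k ℕ.+ k) ≡ (p ℕ.+ k) ℕ.+ (q ℕ.+ k)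
  shuffle p q = solve 3 (λ p q k → p :+ q :+ (k :+ k) := (p :+ k) :+ (q :+ k)) ≡.refl p q k
    where open +-*-Solver

[m+o]∸[n+o]≡m∸n : ∀ m n o → (m ℕ.+ o) ∸ (n ℕ.+ o) ≡ m ∸ n
[m+o]∸[n+o]≡m∸n m n o = ≡.trans (≡.cong₂ _∸_ (ℕP.+-comm m o) (ℕP.+-comm n o)) (ℕP.[m+n]∸[m+o]≡n∸o o m n)

module OrderedCommRingProperties {c ℓ ℓ′} (R : OrderedCommRing c ℓ ℓ′) where
  open OrderedCommRing R hiding (zero)
  open import Algebra.Properties.Ring ring using (-0#≈0#; -‿distribˡ-*; -‿involutive; -‿+-comm)
  open IsStrictTotalOrder isStrictTotalOrder using (isStrictPartialOrder; compare; irrefl; asym)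
  open import Relation.Binary.Construct.StrictToNonStrict _≈_ _<ᴿ_ public
    using () renaming (_≤_ to _≤ᴿ_)

  strictPartialOrder : StrictPartialOrder c ℓ ℓ′
  strictPartialOrder = record { isStrictPartialOrder = isStrictPartialOrder }

  open import Relation.Binary.Reasoning.StrictPartialOrder strictPartialOrder

  +-monoʳ-≤ : ∀ {a b} d → a ≤ᴿ b → a + d ≤ᴿ b + d
  +-monoʳ-≤ d (inj₁ a<b) = inj₁ (+-mono-< d a<b)
  +-monoʳ-≤ d (inj₂ a≈b) = inj₂ (+-congʳ a≈b)

  +-monoˡ-≤ : ∀ {a b} d → a ≤ᴿ b → d + a ≤ᴿ d + b
  +-monoˡ-≤ {a} {b} d a≤b = begin
    d + a ≈⟨ +-comm d a ⟩
    a + d ≤⟨ +-monoʳ-≤ d a≤b ⟩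
    b + d ≈⟨ +-comm b d ⟩
    d + b ∎

  +-mono-≤ : ∀ {a b x y} → a ≤ᴿ b → x ≤ᴿ y → a + x ≤ᴿ b + y
  +-mono-≤ {a} {b} {x} {y} a≤b x≤y = begin
    a + x ≤⟨ +-monoʳ-≤ x a≤b ⟩
    b + x ≤⟨ +-monoˡ-≤ b x≤y ⟩
    b + y ∎

  -‿anti-≤ : ∀ {a b} → a ≤ᴿ b → - b ≤ᴿ - a
  -‿anti-≤ {a} {b} a≤b = begin
    - b                ≈⟨ +-identityˡ (- b) ⟨
    0# + - b           ≈⟨ +-congʳ (-‿inverseʳ a) ⟨
    (a - a) + - b      ≈⟨ +-congʳ (+-comm a (- a)) ⟩
    (- a + a) + - b    ≈⟨ +-assoc (- a) a (- b) ⟩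
    - a + (a - b)      ≤⟨ +-monoˡ-≤ (- a) (+-monoʳ-≤ (- b) a≤b) ⟩
    - a + (b - b)      ≈⟨ +-congˡ (-‿inverseʳ b) ⟩
    - a + 0#           ≈⟨ +-identityʳ (- a) ⟩
    - a ∎

  x≤y∧u≤v⇒x-v≤y-u : ∀ {x y u v} → x ≤ᴿ y → u ≤ᴿ v → x - v ≤ᴿ y - u
  x≤y∧u≤v⇒x-v≤y-u x≤y u≤v = +-mono-≤ x≤y (-‿anti-≤ u≤v)

  0≤y⇒x-y≤x : ∀ {x y} → 0# ≤ᴿ y → x - y ≤ᴿ x
  0≤y⇒x-y≤x {x} {y} 0≤y = begin
    x - y  ≤⟨ x≤y∧u≤v⇒x-v≤y-u (inj₂ refl) 0≤y ⟩
    x - 0# ≈⟨ +-congˡ -0#≈0# ⟩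
    x + 0# ≈⟨ +-identityʳ x ⟩
    x ∎

  x<y⇒0<y-x : ∀ {x y} → x <ᴿ y → 0# <ᴿ (y - x)
  x<y⇒0<y-x {x} {y} x<y = begin-strict
    0#    ≈⟨ -‿inverseʳ x ⟨
    x - x <⟨ +-mono-< (- x) x<y ⟩
    y - x ∎

  x<y⇒0<1 : ∀ {x y} → x <ᴿ y → 0# <ᴿ 1#
  x<y⇒0<1 {x} {y} x<y with compare 0# 1#
  ... | tri< 0<1 _ _ = 0<1
  ... | tri≈ _ 0≈1 _ = ⊥-elim (irrefl (trans (≈0 x) (sym (≈0 y))) x<y)
    where
    ≈0 : ∀ z → z ≈ 0#
    ≈0 z = trans (sym (*-identityʳ z)) (trans (*-congˡ (sym 0≈1)) (zeroʳ z))
  ... | tri> _ _ 1<0 = ⊥-elim (asym 1<0 0<1)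
    where
    0<-1 : 0# <ᴿ (- 1#)
    0<-1 = begin-strict
      0#      ≈⟨ -‿inverseʳ 1# ⟨
      1# - 1# <⟨ +-mono-< (- 1#) 1<0 ⟩
      0# - 1# ≈⟨ +-identityˡ (- 1#) ⟩
      - 1# ∎
    0<1 : 0# <ᴿ 1#
    0<1 = begin-strict
      0#          <⟨ *-pos 0<-1 0<-1 ⟩
      - 1# * - 1# ≈⟨ -‿distribˡ-* 1# (- 1#) ⟨
      - (1# * - 1#) ≈⟨ -‿cong (*-identityˡ (- 1#)) ⟩
      - (- 1#)    ≈⟨ -‿involutive 1# ⟩
      1# ∎

  fromℕ-mono-≤ : 0# <ᴿ 1# → ∀ {m n} → m ≤ n → fromℕ R m ≤ᴿ fromℕ R n
  fromℕ-mono-≤ 0<1 {zero}  {zero}  z≤n       = inj₂ refl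
  fromℕ-mono-≤ 0<1 {zero}  {suc n} z≤n       = begin
    0#              ≤⟨ fromℕ-mono-≤ 0<1 {zero} {n} z≤n ⟩
    fromℕ R n       ≈⟨ +-identityˡ (fromℕ R n) ⟨
    0# + fromℕ R n  <⟨ +-mono-< (fromℕ R n) 0<1 ⟩
    1# + fromℕ R n ∎
  fromℕ-mono-≤ 0<1 {suc m} {suc n} (s≤s m≤n) = +-monoˡ-≤ 1# (fromℕ-mono-≤ 0<1 m≤n)

-- Matroids and their minors

module MatroidProperties {n : ℕ} (M : Matroid n) where
  private
    r = rank M

  rank-⊥ : r ⊥ ≡ 0
  rank-⊥ = ℕP.n≤0⇒n≡0 (≡.subst (r ⊥ ≤_) (∣⊥∣≡0 n) (r-bound M ⊥))

  rank-⁅⁆≤1 : ∀ x → r ⁅ x ⁆ ≤ 1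
  rank-⁅⁆≤1 x = ≡.subst (r ⁅ x ⁆ ≤_) (∣⁅x⁆∣≡1 x) (r-bound M ⁅ x ⁆)

  rank-∪⁅⁆≤1+rank : ∀ A x → r (A ∪ ⁅ x ⁆) ≤ suc (r A)
  rank-∪⁅⁆≤1+rank A x = ℕP.+-cancelʳ-≤ (r (A ∩ ⁅ x ⁆)) _ _ (begin
    r (A ∪ ⁅ x ⁆) ℕ.+ r (A ∩ ⁅ x ⁆) ≤⟨ r-submod M A ⁅ x ⁆ ⟩
    r A ℕ.+ r ⁅ x ⁆                   ≤⟨ ℕP.+-monoʳ-≤ (r A) (rank-⁅⁆≤1 x) ⟩
    r A ℕ.+ 1                         ≡⟨ ℕP.+-comm (r A) 1 ⟩
    suc (r A)                         ≤⟨ ℕP.m≤m+n (suc (r A)) _ ⟩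
    suc (r A) ℕ.+ r (A ∩ ⁅ x ⁆) ∎)
    where open ℕP.≤-Reasoning

  spanned-mono : ∀ {A B} x → A ⊆ B → r (A ∪ ⁅ x ⁆) ≡ r A → r (B ∪ ⁅ x ⁆) ≡ r B
  spanned-mono {A} {B} x A⊆B spanned = ℕP.≤-antisym B∪x≤B (r-mono M (p⊆p∪q ⁅ x ⁆))
    where
    B∪x≤B : r (B ∪ ⁅ x ⁆) ≤ r B
    B∪x≤B = ℕP.+-cancelʳ-≤ (r A) _ _ (begin
      r (B ∪ ⁅ x ⁆) ℕ.+ r A
        ≤⟨ ℕP.+-mono-≤ (r-mono M (∪-least (q⊆p∪q (A ∪ ⁅ x ⁆) B) (λ x∈ → p⊆p∪q B (q⊆p∪q A ⁅ x ⁆ x∈))))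
                        (r-mono M (λ y∈A → x∈p∩q⁺ (p⊆p∪q ⁅ x ⁆ y∈A , A⊆B y∈A))) ⟩
      r ((A ∪ ⁅ x ⁆) ∪ B) ℕ.+ r ((A ∪ ⁅ x ⁆) ∩ B) ≤⟨ r-submod M (A ∪ ⁅ x ⁆) B ⟩
      r (A ∪ ⁅ x ⁆) ℕ.+ r B                       ≡⟨ ≡.cong (ℕ._+ r B) spanned ⟩
      r A ℕ.+ r B                                 ≡⟨ ℕP.+-comm (r A) (r B) ⟩
      r B ℕ.+ r A ∎)
      where open ℕP.≤-Reasoning

  unspanned-antitone : ∀ {A B} x → A ⊆ B → r B < r (B ∪ ⁅ x ⁆) → r (A ∪ ⁅ x ⁆) ≡ suc (r A)
  unspanned-antitone {A} x A⊆B B<B∪x with ℕP.m≤n⇒m<n∨m≡n (r-mono M (p⊆p∪q {p = A} ⁅ x ⁆))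
  ... | inj₁ A<A∪x = ℕP.≤-antisym (rank-∪⁅⁆≤1+rank A x) A<A∪x
  ... | inj₂ A≡A∪x = ⊥-elim (ℕP.<⇒≢ B<B∪x (≡.sym (spanned-mono x A⊆B (≡.sym A≡A∪x))))

  closure : Subset n → Subset n
  closure X = tabulate (λ e → does (r (X ∪ ⁅ e ⁆) ℕ.≟ r X))

  ∈closure⇒spanned : ∀ {X e} → e ∈ closure X → r (X ∪ ⁅ e ⁆) ≡ r X
  ∈closure⇒spanned {X} {e} e∈ = does-true (r (X ∪ ⁅ e ⁆) ℕ.≟ r X)
    (≡.trans (≡.sym (VecP.lookup∘tabulate _ e)) (VecP.[]=⇒lookup e∈))
    where
    does-true : ∀ {P : Set} (P? : Dec P) → does P? ≡ true → P
    does-true (yes p) _ = p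

  spanned⇒∈closure : ∀ {X e} → r (X ∪ ⁅ e ⁆) ≡ r X → e ∈ closure X
  spanned⇒∈closure {X} {e} spanned = VecP.lookup⇒[]= e (closure X)
    (≡.trans (VecP.lookup∘tabulate _ e) (dec-true (r (X ∪ ⁅ e ⁆) ℕ.≟ r X) spanned))

  ⊆-closure : ∀ X → X ⊆ closure X
  ⊆-closure X x∈X = spanned⇒∈closure
    (ℕP.≤-antisym (r-mono M (∪-least ⊆-refl (⁅x⁆⊆p x∈X))) (r-mono M (p⊆p∪q _)))

  rank-∪-⊆closure : ∀ k X A → ∣ A ∣ ≤ k → A ⊆ closure X → r (X ∪ A) ≡ r X
  rank-∪-⊆closure k X A ∣A∣≤k A⊆cl with ⊆⊎⊈ ⊥ A
  ... | inj₁ A⊆⊥ = ≡.cong r (≡.trans (≡.cong (X ∪_) (⊆-antisym A⊆⊥ (⊆-min A))) (∪-identityʳ X))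
  rank-∪-⊆closure zero    X A ∣A∣≤k A⊆cl | inj₂ (x , x∈A , _)
    with ≡.subst (_≤ 0) (∣p∣≡1+∣p[x]≔outside∣ x∈A) ∣A∣≤k
  ... | ()
  rank-∪-⊆closure (suc k) X A ∣A∣≤k A⊆cl | inj₂ (x , x∈A , _) =
    ℕP.≤-antisym X∪A≤X (r-mono M (p⊆p∪q A))
    where
    A′ = A [ x ]≔ outside
    X∪A′≡X : r (X ∪ A′) ≡ r X
    X∪A′≡X = rank-∪-⊆closure k X A′
      (ℕP.≤-pred (≡.subst (_≤ suc k) (∣p∣≡1+∣p[x]≔outside∣ x∈A) ∣A∣≤k))
      (λ y∈ → A⊆cl (p[x]≔outside⊆p A x y∈))
    X∪A⊆ : X ∪ A ⊆ (X ∪ A′) ∪ ⁅ x ⁆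
    X∪A⊆ = ∪-least (λ y∈X → p⊆p∪q ⁅ x ⁆ (p⊆p∪q A′ y∈X)) A⊆
      where
      A⊆ : A ⊆ (X ∪ A′) ∪ ⁅ x ⁆
      A⊆ {y} y∈A with y FinP.≟ x
      ... | yes ≡.refl = q⊆p∪q (X ∪ A′) ⁅ x ⁆ (x∈⁅x⁆ x)
      ... | no  y≢x    = p⊆p∪q ⁅ x ⁆ (q⊆p∪q X A′ (y∈p⇒y∈p[x]≔b A outside y≢x y∈A))
    X∪A≤X : r (X ∪ A) ≤ r X
    X∪A≤X = ℕP.≤-trans (r-mono M X∪A⊆) (ℕP.≤-reflexive
      (≡.trans (spanned-mono x (p⊆p∪q A′) (∈closure⇒spanned (A⊆cl x∈A))) X∪A′≡X))

  rank-closure : ∀ X → r (closure X) ≡ r X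
  rank-closure X = ℕP.≤-antisym
    (ℕP.≤-trans (r-mono M (q⊆p∪q X (closure X)))
                (ℕP.≤-reflexive (rank-∪-⊆closure _ X (closure X) ℕP.≤-refl ⊆-refl)))
    (r-mono M (⊆-closure X))

  closure-isFlat : ∀ X → IsFlat M (closure X)
  closure-isFlat X e e∉cl = ≡.subst (_< r (closure X ∪ ⁅ e ⁆)) (≡.sym (rank-closure X))
    (ℕP.<-≤-trans X<X∪e (r-mono M (∪-monoˡ-⊆ ⁅ e ⁆ (⊆-closure X))))
    where
    X<X∪e : r X < r (X ∪ ⁅ e ⁆)
    X<X∪e with ℕP.m≤n⇒m<n∨m≡n (r-mono M (p⊆p∪q {p = X} ⁅ e ⁆))
    ... | inj₁ X<X∪e = X<X∪e
    ... | inj₂ X≡X∪e = ⊥-elim (e∉cl (spanned⇒∈closure (≡.sym X≡X∪e)))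

  closure-least : ∀ {X F} → IsFlat M F → X ⊆ F → closure X ⊆ F
  closure-least {X} {F} F-flat X⊆F {e} e∈cl with e ∈? F
  ... | yes e∈F = e∈F
  ... | no  e∉F = ⊥-elim (ℕP.<-irrefl (≡.sym (spanned-mono e X⊆F (∈closure⇒spanned e∈cl))) (F-flat e e∉F))

module _ {n : ℕ} (M : Matroid (suc n)) (i : Fin (suc n)) where

  deletion : Matroid n
  deletion = record
    { rank     = λ X → rank M (insertAt X i outside)
    ; r-bound  = λ X → ≡.subst (rank M (insertAt X i outside) ≤_) (∣insertAt-outside∣ X i) (r-bound M _)
    ; r-mono   = λ X⊆Y → r-mono M (insertAt-mono-⊆ i outside X⊆Y)
    ; r-submod = λ X Y → ≡.subst₂ (λ U V → rank M U ℕ.+ rank M V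
                                   ≤ rank M (insertAt X i outside) ℕ.+ rank M (insertAt Y i outside))
                   (insertAt-∪ X Y i outside outside) (insertAt-∩ X Y i outside outside) (r-submod M _ _)
    }

  deletion-isDeletion : IsDeletion M i deletion
  deletion-isDeletion X = ≡.refl

  private
    r = rank M
    k = r ⁅ i ⁆

    k≤rank-inside : ∀ X → k ≤ r (insertAt X i inside)
    k≤rank-inside X = r-mono M (λ x∈⁅i⁆ → insertAt-mono-⊆ i inside (⊆-min X)
      (≡.subst (_ ∈_) (≡.sym (insertAt-⊥-inside i)) x∈⁅i⁆))

    rank-inside≤rank-outside+k : ∀ X → r (insertAt X i inside) ≤ r (insertAt X i outside) ℕ.+ k
    rank-inside≤rank-outside+k X = begin
      r (insertAt X i inside)                                  ≡⟨ ≡.cong r (insertAt-∪⁅⁆ X i) ⟨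
      r (insertAt X i outside ∪ ⁅ i ⁆)                         ≤⟨ ℕP.m≤m+n _ _ ⟩
      r (insertAt X i outside ∪ ⁅ i ⁆) ℕ.+ r (insertAt X i outside ∩ ⁅ i ⁆) ≤⟨ r-submod M _ _ ⟩
      r (insertAt X i outside) ℕ.+ k ∎
      where open ℕP.≤-Reasoning

  contraction : Matroid n
  contraction = record
    { rank     = λ X → r (insertAt X i inside) ∸ k
    ; r-bound  = λ X → ℕP.≤-trans (ℕP.∸-monoˡ-≤ k (rank-inside≤rank-outside+k X))
        (ℕP.≤-trans (ℕP.≤-reflexive (ℕP.m+n∸n≡m _ k))
          (≡.subst (r (insertAt X i outside) ≤_) (∣insertAt-outside∣ X i) (r-bound M _)))
    ; r-mono   = λ X⊆Y → ℕP.∸-monoˡ-≤ k (r-mono M (insertAt-mono-⊆ i inside X⊆Y))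
    ; r-submod = λ X Y → ≡.subst₂ (λ U V → (r U ∸ k) ℕ.+ (r V ∸ k)
                                   ≤ (r (insertAt X i inside) ∸ k) ℕ.+ (r (insertAt Y i inside) ∸ k))
        (insertAt-∪ X Y i inside inside) (insertAt-∩ X Y i inside inside)
        (∸-mono-+-≤ (≡.subst (λ U → k ≤ r U) (≡.sym (insertAt-∪ X Y i inside inside)) (k≤rank-inside (X ∪ Y)))
                    (≡.subst (λ U → k ≤ r U) (≡.sym (insertAt-∩ X Y i inside inside)) (k≤rank-inside (X ∩ Y)))
                    (k≤rank-inside X) (k≤rank-inside Y) (r-submod M _ _))
    }

  contraction-isContraction : IsContraction M i contraction
  contraction-isContraction X = ℕP.m∸n+n≡m (k≤rank-inside X)

insertAt-spanned : ∀ {n} (N : Matroid (suc n)) (C : Subset n) i →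
  rank N (insertAt C i inside) ≡ rank N (insertAt C i outside) →
  ∀ X → rank N (insertAt X i inside ∪ insertAt C i outside) ≡ rank N (insertAt X i outside ∪ insertAt C i outside)
insertAt-spanned N C i spanned X = begin
  r (insertAt X i inside ∪ insertAt C i outside) ≡⟨ ≡.cong r (insertAt-∪ X C i inside outside) ⟩
  r (insertAt (X ∪ C) i inside)                  ≡⟨ ≡.cong r (insertAt-∪⁅⁆ (X ∪ C) i) ⟨
  r (insertAt (X ∪ C) i outside ∪ ⁅ i ⁆)         ≡⟨ MatroidProperties.spanned-mono N i
                                                      (insertAt-mono-⊆ i outside (q⊆p∪q X C))
                                                      (≡.trans (≡.cong r (insertAt-∪⁅⁆ C i)) spanned) ⟩
  r (insertAt (X ∪ C) i outside)                 ≡⟨ ≡.cong r (insertAt-∪ X C i outside outside) ⟨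
  r (insertAt X i outside ∪ insertAt C i outside) ∎
  where
  open ≡.≡-Reasoning
  r = rank N

-- Rota's crosscut formula

sign : ∀ {a} {A : Set a} (one : A) (neg : A → A) {n} → Subset n → A
sign one neg []            = one
sign one neg (inside ∷ X)  = neg (sign one neg X)
sign one neg (outside ∷ X) = sign one neg X

module ℤSum = SubsetSum ℤP.+-0-commutativeMonoid

sgnℤ : ∀ {n} → Subset n → ℤ
sgnℤ = sign (+ 1) (ℤ.-_)

module _ where
  open ℤSum

  ∑⊆-sgnℤ : ∀ {n} (F : Subset n) → ∑⊆ F sgnℤ ≡ when (isEmpty? F) (+ 1)
  ∑⊆-sgnℤ []            = ≡.refl
  ∑⊆-sgnℤ (inside ∷ F)  = begin
    ∑⊆ F (λ X → ℤ.- sgnℤ X) ℤ.+ ∑⊆ F sgnℤ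
      ≡⟨ ≡.cong (ℤ._+ ∑⊆ F sgnℤ) (≡.sym (ℤ-neg.∑⊆-hom F sgnℤ)) ⟩
    ℤ.- ∑⊆ F sgnℤ ℤ.+ ∑⊆ F sgnℤ           ≡⟨ ℤP.+-inverseˡ (∑⊆ F sgnℤ) ⟩
    + 0                                   ≡⟨ when-no (isEmpty? (inside ∷ F)) {+ 1} (λ ()) ⟨
    when (isEmpty? (inside ∷ F)) (+ 1) ∎
    where
    open ≡.≡-Reasoning
    module ℤ-neg = SubsetSumHomomorphism ℤP.+-0-commutativeMonoid ℤP.+-0-commutativeMonoid
                     (ℤ.-_) (≡.cong (ℤ.-_)) ℤP.neg-distrib-+
  ∑⊆-sgnℤ (outside ∷ F) = ≡.trans (∑⊆-sgnℤ F)
    (when-⇔ (isEmpty? F) (isEmpty? (outside ∷ F)) (≡.cong (outside ∷_)) ∷-injectiveʳ)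

module Crosscut {n : ℕ} (M : Matroid n) where
  open MatroidProperties M
  open ℤSum

  -- equals μ(∅, F) for every flat F
  crosscut : Subset n → ℤ
  crosscut F = ∑⊆ ⊤ (λ X → when (closure X ≟ˢ F) (sgnℤ X))

  ∑flats : ∀ {p} {P : Subset n → Set p} → Relation.Unary.Decidable P → (Subset n → ℤ) → ℤ
  ∑flats P? φ = ∑⊆ ⊤ (λ G → when (flat? M G) (when (P? G) (φ G)))

  ∑flats⊆-crosscut : ∀ F → IsFlat M F → ∑flats (_⊆? F) crosscut ≡ when (isEmpty? F) (+ 1)
  ∑flats⊆-crosscut F F-flat = begin
    ∑⊆ ⊤ (λ G → when (flat? M G) (when (G ⊆? F) (∑⊆ ⊤ (λ X → when (closure X ≟ˢ G) (sgnℤ X)))))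
      ≡⟨ ∑⊆-cong (⊤ {n}) (λ G _ → ≡.cong (when (flat? M G)) (≡.trans (when-∑⊆ (G ⊆? F) (⊤ {n}) _)
           (∑⊆-cong (⊤ {n}) (λ X _ → when-comm (G ⊆? F) (closure X ≟ˢ G))))) ⟩
    ∑⊆ ⊤ (λ G → when (flat? M G) (∑⊆ ⊤ (λ X → when (closure X ≟ˢ G) (when (G ⊆? F) (sgnℤ X)))))
      ≡⟨ ∑⊆-fibres (flat? M) closure closure-isFlat (λ X G → when (G ⊆? F) (sgnℤ X)) ⟩
    ∑⊆ ⊤ (λ X → when (closure X ⊆? F) (sgnℤ X))
      ≡⟨ ∑⊆-cong (⊤ {n}) (λ X _ → when-⇔ (closure X ⊆? F) (X ⊆? F)
           (λ cl⊆F x∈X → cl⊆F (⊆-closure X x∈X)) (closure-least F-flat)) ⟩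
    ∑⊆ ⊤ (λ X → when (X ⊆? F) (sgnℤ X)) ≡⟨ ∑⊆-⊤-when-⊆ F sgnℤ ⟩
    ∑⊆ F sgnℤ                           ≡⟨ ∑⊆-sgnℤ F ⟩
    when (isEmpty? F) (+ 1) ∎
    where open ≡.≡-Reasoning

  ∑flats⊆≡∑flats⊂+ : ∀ F → IsFlat M F → ∀ φ → ∑flats (_⊆? F) φ ≡ ∑flats (_⊂? F) φ ℤ.+ φ F
  ∑flats⊆≡∑flats⊂+ F F-flat φ = begin
    ∑flats (_⊆? F) φ
      ≡⟨ ∑⊆-cong (⊤ {n}) (λ G _ → ≡.trans (≡.cong (when (flat? M G)) (⊆-split G)) (when-∙ (flat? M G) _ _)) ⟩
    ∑⊆ ⊤ (λ G → when (flat? M G) (when (G ⊂? F) (φ G)) ℤ.+ when (flat? M G) (when (G ≟ˢ F) (φ G)))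
      ≡⟨ ∑⊆-∙ (⊤ {n}) _ _ ⟩
    ∑flats (_⊂? F) φ ℤ.+ ∑flats (_≟ˢ F) φ
      ≡⟨ ≡.cong (λ z → ∑flats (_⊂? F) φ ℤ.+ z) (∑⊆-single (⊤ {n}) F _ ⊆⊤ (λ G G≢F →
           ≡.trans (≡.cong (when (flat? M G)) (when-no (G ≟ˢ F) G≢F)) (when-ε (flat? M G)))) ⟩
    ∑flats (_⊂? F) φ ℤ.+ when (flat? M F) (when (F ≟ˢ F) (φ F))
      ≡⟨ ≡.cong (λ z → ∑flats (_⊂? F) φ ℤ.+ z) (≡.trans (when-yes (flat? M F) F-flat) (when-yes (F ≟ˢ F) ≡.refl)) ⟩
    ∑flats (_⊂? F) φ ℤ.+ φ F ∎
    where
    open ≡.≡-Reasoning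
    ⊆-split : ∀ G → when (G ⊆? F) (φ G) ≡ when (G ⊂? F) (φ G) ℤ.+ when (G ≟ˢ F) (φ G)
    ⊆-split G with G ≟ˢ F
    ... | yes ≡.refl = ≡.trans (when-yes (G ⊆? G) ⊆-refl)
                         (≡.sym (≡.trans (≡.cong (ℤ._+ φ G) (when-no (G ⊂? G) (⊂-irref ≡.refl))) (ℤP.+-identityˡ _)))
    ... | no  G≢F with G ⊆? F
    ...   | no  G⊈F = ≡.sym (≡.cong (ℤ._+ + 0) (when-no (G ⊂? F) (λ G⊂F → G⊈F (p⊂q⇒p⊆q G⊂F))))
    ...   | yes G⊆F with ⊆⊎⊈ G F
    ...     | inj₁ F⊆G   = ⊥-elim (G≢F (⊆-antisym G⊆F F⊆G))
    ...     | inj₂ F⊈G   = ≡.sym (≡.trans (≡.cong (ℤ._+ + 0) (when-yes (G ⊂? F) (G⊆F , F⊈G))) (ℤP.+-identityʳ _))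

  crosscut-recursion : ∀ F → IsFlat M F → ∑flats (_⊂? F) crosscut ℤ.+ crosscut F ≡ when (isEmpty? F) (+ 1)
  crosscut-recursion F F-flat = ≡.trans (≡.sym (∑flats⊆≡∑flats⊂+ F F-flat crosscut)) (∑flats⊆-crosscut F F-flat)

  crosscut-⊥ : IsFlat M ⊥ → crosscut ⊥ ≡ + 1
  crosscut-⊥ ⊥-flat = begin
    crosscut ⊥                                   ≡⟨ ℤP.+-identityˡ _ ⟨
    + 0 ℤ.+ crosscut ⊥                           ≡⟨ ≡.cong (ℤ._+ crosscut ⊥) nothing-below ⟨
    ∑flats (_⊂? ⊥) crosscut ℤ.+ crosscut ⊥       ≡⟨ crosscut-recursion ⊥ ⊥-flat ⟩
    when (isEmpty? (⊥ {n})) (+ 1)                ≡⟨ when-yes (isEmpty? (⊥ {n})) ≡.refl ⟩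
    + 1 ∎
    where
    open ≡.≡-Reasoning
    nothing-below : ∑flats (_⊂? ⊥) crosscut ≡ + 0
    nothing-below = ∑⊆-ε (⊤ {n}) _ (λ G → ≡.trans (≡.cong (when (flat? M G))
      (when-no (G ⊂? ⊥) (λ (_ , _ , x∈⊥ , _) → ∉⊥ x∈⊥))) (when-ε (flat? M G)))

  sumℤ-flats⊂ : ∀ F φ → sumℤ (map φ (filter (_⊂? F) (flats M))) ≡ ∑flats (_⊂? F) φ
  sumℤ-flats⊂ F φ = begin
    sumℤ (map φ (filter (_⊂? F) (flats M)))
      ≡⟨ sumℤ≡sumList (map φ (filter (_⊂? F) (flats M))) ⟩
    sumList (map φ (filter (_⊂? F) (filter (flat? M) (allSubsets n))))
      ≡⟨ sumList-filter (_⊂? F) φ (flats M) ⟩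
    sumList (map (λ G → when (G ⊂? F) (φ G)) (filter (flat? M) (allSubsets n)))
      ≡⟨ sumList-filter (flat? M) (λ G → when (G ⊂? F) (φ G)) (allSubsets n) ⟩
    sumList (map (λ G → when (flat? M G) (when (G ⊂? F) (φ G))) (allSubsets n)) ≡⟨ sumList-allSubsets n _ ⟩
    ∑flats (_⊂? F) φ ∎
    where
    open ≡.≡-Reasoning
    sumℤ≡sumList : ∀ xs → sumℤ xs ≡ sumList xs
    sumℤ≡sumList []       = ≡.refl
    sumℤ≡sumList (x ∷ xs) = ≡.cong (λ z → x ℤ.+ z) (sumℤ≡sumList xs)

  möbiusFuel-crosscut : ∀ k F → IsFlat M F → ∣ F ∣ ≤ k → möbiusFuel M k F ≡ crosscut F
  möbiusFuel-crosscut zero F F-flat ∣F∣≤0 with isEmpty? F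
  ... | yes ≡.refl = ≡.sym (crosscut-⊥ F-flat)
  ... | no  F≢⊥    = ⊥-elim (F≢⊥ (≡.sym (p⊆q∧∣q∣≤∣p∣⇒p≡q ⊥ F (⊆-min F) (≡.subst (∣ F ∣ ≤_) (≡.sym (∣⊥∣≡0 n)) ∣F∣≤0))))
  möbiusFuel-crosscut (suc k) F F-flat ∣F∣≤k with isEmpty? F
  ... | yes ≡.refl = ≡.sym (crosscut-⊥ F-flat)
  ... | no  F≢⊥    = begin
    ℤ.- sumℤ (map (möbiusFuel M k) (filter (_⊂? F) (flats M))) ≡⟨ ≡.cong (ℤ.-_) (sumℤ-flats⊂ F (möbiusFuel M k)) ⟩
    ℤ.- ∑flats (_⊂? F) (möbiusFuel M k)
      ≡⟨ ≡.cong (ℤ.-_) (∑⊆-cong ⊤ (λ G _ → when-cong (flat? M G) (λ G-flat → when-cong (G ⊂? F) (λ G⊂F →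
           möbiusFuel-crosscut k G G-flat (ℕP.≤-pred (ℕP.≤-trans (p⊂q⇒∣p∣<∣q∣ G⊂F) ∣F∣≤k)))))) ⟩
    ℤ.- ∑flats (_⊂? F) crosscut
      ≡⟨ ≡.sym (ℤGroup.inverseʳ-unique _ _ (≡.trans (crosscut-recursion F F-flat) (when-no (isEmpty? F) F≢⊥))) ⟩
    crosscut F ∎
    where
    open ≡.≡-Reasoning
    module ℤGroup = Algebra.Properties.AbelianGroup ℤP.+-0-abelianGroup

  möbius≡crosscut : ∀ F → IsFlat M F → möbius M F ≡ crosscut F
  möbius≡crosscut F F-flat = möbiusFuel-crosscut ∣ F ∣ F F-flat ℕP.≤-refl

module IntegerEmbedding {c ℓ ℓ′} (R : OrderedCommRing c ℓ ℓ′) where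
  open OrderedCommRing R hiding (zero)
  open import Algebra.Properties.Ring ring using (-0#≈0#; -‿+-comm; -‿involutive)
  open import Relation.Binary.Reasoning.Setoid setoid

  fromℕ-+ : ∀ m n → fromℕ R (m ℕ.+ n) ≈ fromℕ R m + fromℕ R n
  fromℕ-+ zero    n = sym (+-identityˡ _)
  fromℕ-+ (suc m) n = trans (+-congˡ (fromℕ-+ m n)) (sym (+-assoc _ _ _))

  fromℤ-⊖ : ∀ m n → fromℤ R (m ℤ.⊖ n) ≈ fromℕ R m - fromℕ R n
  fromℤ-⊖ m       zero    = sym (trans (+-congˡ -0#≈0#) (+-identityʳ _))
  fromℤ-⊖ zero    (suc n) = sym (+-identityˡ _)
  fromℤ-⊖ (suc m) (suc n) = begin
    fromℤ R (suc m ℤ.⊖ suc n)              ≡⟨ ≡.cong (fromℤ R) (ℤP.[1+m]⊖[1+n]≡m⊖n m n) ⟩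
    fromℤ R (m ℤ.⊖ n)                      ≈⟨ fromℤ-⊖ m n ⟩
    a - b                                  ≈⟨ +-congˡ (+-identityˡ (- b)) ⟨
    a + (0# + - b)                         ≈⟨ +-congˡ (+-congʳ (-‿inverseʳ 1#)) ⟨
    a + ((1# - 1#) + - b)                  ≈⟨ +-congˡ (+-assoc 1# (- 1#) (- b)) ⟩
    a + (1# + (- 1# + - b))                ≈⟨ +-assoc a 1# _ ⟨
    (a + 1#) + (- 1# + - b)                ≈⟨ +-cong (+-comm a 1#) (-‿+-comm 1# b) ⟩
    (1# + a) - (1# + b) ∎
    where
    a = fromℕ R m
    b = fromℕ R n

  fromℤ-+ : ∀ a b → fromℤ R (a ℤ.+ b) ≈ fromℤ R a + fromℤ R b
  fromℤ-+ -[1+ m ] -[1+ n ] = trans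
    (-‿cong (trans (reflexive (≡.cong (λ k → fromℕ R (suc k)) (≡.sym (ℕP.+-suc m n)))) (fromℕ-+ (suc m) (suc n))))
    (sym (-‿+-comm _ _))
  fromℤ-+ -[1+ m ] (+ n)    = trans (fromℤ-⊖ n (suc m)) (+-comm _ _)
  fromℤ-+ (+ m)    -[1+ n ] = fromℤ-⊖ m (suc n)
  fromℤ-+ (+ m)    (+ n)    = fromℕ-+ m n

  fromℤ-neg : ∀ a → fromℤ R (ℤ.- a) ≈ - fromℤ R a
  fromℤ-neg -[1+ n ]    = sym (-‿involutive _)
  fromℤ-neg (+ zero)    = sym -0#≈0#
  fromℤ-neg (+ (suc n)) = refl

  fromℤ-sgnℤ : ∀ {n} (X : Subset n) → fromℤ R (sgnℤ X) ≈ sign 1# (-_) X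
  fromℤ-sgnℤ []            = +-identityʳ 1#
  fromℤ-sgnℤ (inside ∷ X)  = trans (fromℤ-neg (sgnℤ X)) (-‿cong (fromℤ-sgnℤ X))
  fromℤ-sgnℤ (outside ∷ X) = fromℤ-sgnℤ X

-- Whitney's expansion of the characteristic polynomial

module Whitney {c ℓ ℓ′} (R : OrderedCommRing c ℓ ℓ′) (t : OrderedCommRing.Carrier R) where
  open OrderedCommRing R hiding (zero)
  open import Algebra.Properties.Ring ring using (-‿distribˡ-*; -‿+-comm)
  open SubsetSum +-commutativeMonoid public
  open import Relation.Binary.Reasoning.Setoid setoid

  t^ : ℕ → Carrier
  t^ = pow R t

  sgn : ∀ {n} → Subset n → Carrier
  sgn = sign 1# (-_)

  whitneyTerm : ∀ {n} → Matroid n → Subset n → Subset n → Subset n → Carrier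
  whitneyTerm N S C X = sgn X * t^ (rank N (S ∪ C) ∸ rank N (X ∪ C))

  -- For disjoint S and C this is Whitney's subset expansion of the characteristic
  -- polynomial of the minor (N / C) | S, evaluated at t.
  whitney : ∀ {n} → Matroid n → Subset n → Subset n → Carrier
  whitney N S C = ∑⊆ S (whitneyTerm N S C)

  t^-+ : ∀ a b → t^ (a ℕ.+ b) ≈ t^ a * t^ b
  t^-+ zero    b = sym (*-identityˡ _)
  t^-+ (suc a) b = trans (*-congˡ (t^-+ a b)) (sym (*-assoc _ _ _))

  sgn-insertAt-inside : ∀ {n} (X : Subset n) i → sgn (insertAt X i inside) ≈ - sgn X
  sgn-insertAt-inside X             zero    = refl
  sgn-insertAt-inside (inside ∷ X)  (suc i) = -‿cong (sgn-insertAt-inside X i)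
  sgn-insertAt-inside (outside ∷ X) (suc i) = sgn-insertAt-inside X i

  sgn-insertAt-outside : ∀ {n} (X : Subset n) i → sgn (insertAt X i outside) ≡ sgn X
  sgn-insertAt-outside X             zero    = ≡.refl
  sgn-insertAt-outside (inside ∷ X)  (suc i) = ≡.cong (-_) (sgn-insertAt-outside X i)
  sgn-insertAt-outside (outside ∷ X) (suc i) = sgn-insertAt-outside X i

  private
    module +-Hom = SubsetSumHomomorphism +-commutativeMonoid +-commutativeMonoid

  ∑⊆-*ˡ : ∀ {n} (S : Subset n) a h → ∑⊆ S (λ X → a * h X) ≈ a * ∑⊆ S h
  ∑⊆-*ˡ S a h = sym (+-Hom.∑⊆-hom (a *_) *-congˡ (distribˡ a) S h)

  ∑⊆-*ʳ : ∀ {n} (S : Subset n) a h → ∑⊆ S (λ X → h X * a) ≈ ∑⊆ S h * a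
  ∑⊆-*ʳ S a h = trans (∑⊆-cong S (λ X _ → *-comm (h X) a)) (trans (∑⊆-*ˡ S a h) (*-comm a _))

  ∑⊆-neg : ∀ {n} (S : Subset n) h → ∑⊆ S (λ X → - h X) ≈ - ∑⊆ S h
  ∑⊆-neg S h = sym (+-Hom.∑⊆-hom (-_) -‿cong (λ a b → sym (-‿+-comm a b)) S h)

  whitney-deletion : ∀ {n} (N : Matroid (suc n)) i (N′ : Matroid n) → IsDeletion N i N′ →
    ∀ S C → whitney N′ S C ≈ whitney N (insertAt S i outside) (insertAt C i outside)
  whitney-deletion N i N′ del S C =
    sym (trans (∑⊆-insertAt-outside S i _) (∑⊆-cong S (λ X _ → term X)))
    where
    term : ∀ X → whitneyTerm N (insertAt S i outside) (insertAt C i outside) (insertAt X i outside)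
               ≈ whitneyTerm N′ S C X
    term X = *-cong (reflexive (sgn-insertAt-outside X i)) (reflexive (≡.cong t^ (≡.cong₂ _∸_
      (≡.trans (≡.cong (rank N) (insertAt-∪ S C i outside outside)) (≡.sym (del (S ∪ C))))
      (≡.trans (≡.cong (rank N) (insertAt-∪ X C i outside outside)) (≡.sym (del (X ∪ C)))))))

  whitney-contraction : ∀ {n} (N : Matroid (suc n)) i (N′ : Matroid n) → IsContraction N i N′ →
    ∀ S C → whitney N′ S C ≈ whitney N (insertAt S i outside) (insertAt C i inside)
  whitney-contraction N i N′ con S C =
    sym (trans (∑⊆-insertAt-outside S i _) (∑⊆-cong S (λ X _ → term X)))
    where
    k = rank N ⁅ i ⁆
    term : ∀ X → whitneyTerm N (insertAt S i outside) (insertAt C i inside) (insertAt X i outside)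
               ≈ whitneyTerm N′ S C X
    term X = *-cong (reflexive (sgn-insertAt-outside X i)) (reflexive (≡.cong t^ (≡.trans
      (≡.cong₂ _∸_ (≡.trans (≡.cong (rank N) (insertAt-∪ S C i outside inside)) (≡.sym (con (S ∪ C))))
                   (≡.trans (≡.cong (rank N) (insertAt-∪ X C i outside inside)) (≡.sym (con (X ∪ C)))))
      ([m+o]∸[n+o]≡m∸n (rank N′ (S ∪ C)) (rank N′ (X ∪ C)) k))))

  private
    whitney-insertAt-deleteContract :
      ∀ {n} (N : Matroid (suc n)) (S′ C′ : Subset n) i {S S₀ C C₁} →
      insertAt S′ i inside ≡ S → insertAt S′ i outside ≡ S₀ →
      insertAt C′ i outside ≡ C → insertAt C′ i inside ≡ C₁ →
      whitney N S C ≈ t^ (rank N (S ∪ C) ∸ rank N (S₀ ∪ C)) * whitney N S₀ C - whitney N S₀ C₁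
    whitney-insertAt-deleteContract N S′ C′ i ≡.refl ≡.refl ≡.refl ≡.refl = begin
      ∑⊆ Sᵢ (whitneyTerm N Sᵢ Cₒ)
        ≈⟨ ∑⊆-insertAt-inside S′ i _ ⟩
      ∑⊆ S′ (λ X → whitneyTerm N Sᵢ Cₒ (insertAt X i inside)) + ∑⊆ S′ (λ X → whitneyTerm N Sᵢ Cₒ (insertAt X i outside))
        ≈⟨ +-cong (∑⊆-cong S′ (λ X _ → contracted X)) (∑⊆-cong S′ deleted) ⟩
      ∑⊆ S′ (λ X → - whitneyTerm N Sₒ Cᵢ (insertAt X i outside))
        + ∑⊆ S′ (λ X → t^ δ * whitneyTerm N Sₒ Cₒ (insertAt X i outside))
        ≈⟨ +-cong (∑⊆-neg S′ _) (∑⊆-*ˡ S′ (t^ δ) _) ⟩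
      - ∑⊆ S′ (λ X → whitneyTerm N Sₒ Cᵢ (insertAt X i outside))
        + t^ δ * ∑⊆ S′ (λ X → whitneyTerm N Sₒ Cₒ (insertAt X i outside))
        ≈⟨ +-cong (-‿cong (sym (∑⊆-insertAt-outside S′ i _))) (*-congˡ (sym (∑⊆-insertAt-outside S′ i _))) ⟩
      - whitney N Sₒ Cᵢ + t^ δ * whitney N Sₒ Cₒ ≈⟨ +-comm _ _ ⟩
      t^ δ * whitney N Sₒ Cₒ - whitney N Sₒ Cᵢ ∎
      where
      r = rank N
      Sᵢ = insertAt S′ i inside
      Sₒ = insertAt S′ i outside
      Cᵢ = insertAt C′ i inside
      Cₒ = insertAt C′ i outside
      δ = r (Sᵢ ∪ Cₒ) ∸ r (Sₒ ∪ Cₒ)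
      moveᵢ : ∀ X → insertAt X i inside ∪ Cₒ ≡ insertAt X i outside ∪ Cᵢ
      moveᵢ X = ≡.trans (insertAt-∪ X C′ i inside outside) (≡.sym (insertAt-∪ X C′ i outside inside))
      contracted : ∀ X → whitneyTerm N Sᵢ Cₒ (insertAt X i inside) ≈ - whitneyTerm N Sₒ Cᵢ (insertAt X i outside)
      contracted X = begin
        sgn (insertAt X i inside) * t^ (r (Sᵢ ∪ Cₒ) ∸ r (insertAt X i inside ∪ Cₒ))
          ≈⟨ *-cong (sgn-insertAt-inside X i)
                    (reflexive (≡.cong₂ (λ a b → t^ (r a ∸ r b)) (moveᵢ S′) (moveᵢ X))) ⟩
        - sgn X * t^ (r (Sₒ ∪ Cᵢ) ∸ r (insertAt X i outside ∪ Cᵢ))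
          ≈⟨ -‿distribˡ-* _ _ ⟨
        - (sgn X * t^ (r (Sₒ ∪ Cᵢ) ∸ r (insertAt X i outside ∪ Cᵢ)))
          ≈⟨ -‿cong (*-congʳ (reflexive (≡.sym (sgn-insertAt-outside X i)))) ⟩
        - whitneyTerm N Sₒ Cᵢ (insertAt X i outside) ∎
      deleted : ∀ X → X ⊆ S′ →
        whitneyTerm N Sᵢ Cₒ (insertAt X i outside) ≈ t^ δ * whitneyTerm N Sₒ Cₒ (insertAt X i outside)
      deleted X X⊆S′ = begin
        sgn Xₒ * t^ (r (Sᵢ ∪ Cₒ) ∸ r (Xₒ ∪ Cₒ))
          ≈⟨ *-congˡ (reflexive (≡.cong t^ (∸-split Xₒ∪Cₒ≤Sₒ∪Cₒ Sₒ∪Cₒ≤Sᵢ∪Cₒ))) ⟩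
        sgn Xₒ * t^ (δ ℕ.+ (r (Sₒ ∪ Cₒ) ∸ r (Xₒ ∪ Cₒ))) ≈⟨ *-congˡ (t^-+ δ _) ⟩
        sgn Xₒ * (t^ δ * t^ (r (Sₒ ∪ Cₒ) ∸ r (Xₒ ∪ Cₒ)))
          ≈⟨ trans (sym (*-assoc _ _ _)) (trans (*-congʳ (*-comm _ _)) (*-assoc _ _ _)) ⟩
        t^ δ * whitneyTerm N Sₒ Cₒ Xₒ ∎
        where
        Xₒ = insertAt X i outside
        ∸-split : ∀ {a b d} → d ≤ b → b ≤ a → a ∸ d ≡ (a ∸ b) ℕ.+ (b ∸ d)
        ∸-split {a} {b} {d} d≤b b≤a =
          ≡.trans (≡.cong (_∸ d) (≡.sym (ℕP.m∸n+n≡m b≤a))) (ℕP.+-∸-assoc (a ∸ b) d≤b)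
        Xₒ∪Cₒ≤Sₒ∪Cₒ : r (Xₒ ∪ Cₒ) ≤ r (Sₒ ∪ Cₒ)
        Xₒ∪Cₒ≤Sₒ∪Cₒ = r-mono N (∪-monoˡ-⊆ Cₒ (insertAt-mono-⊆ i outside X⊆S′))
        Sₒ∪Cₒ≤Sᵢ∪Cₒ : r (Sₒ ∪ Cₒ) ≤ r (Sᵢ ∪ Cₒ)
        Sₒ∪Cₒ≤Sᵢ∪Cₒ = r-mono N (∪-monoˡ-⊆ Cₒ (insertAt-outside⊆inside S′ i))

    whitney-insertAt-loop : ∀ {n} (N : Matroid (suc n)) (S′ C′ : Subset n) i {S C} →
      insertAt S′ i inside ≡ S → insertAt C′ i outside ≡ C →
      rank N (insertAt C′ i inside) ≡ rank N (insertAt C′ i outside) → whitney N S C ≈ 0#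
    whitney-insertAt-loop N S′ C′ i ≡.refl ≡.refl loop = begin
      ∑⊆ Sᵢ h                                                        ≈⟨ ∑⊆-insertAt-inside S′ i h ⟩
      ∑⊆ S′ (λ X → h (insertAt X i inside)) + ∑⊆ S′ (λ X → h (insertAt X i outside)) ≈⟨ ∑⊆-∙ S′ _ _ ⟨
      ∑⊆ S′ (λ X → h (insertAt X i inside) + h (insertAt X i outside)) ≈⟨ ∑⊆-ε S′ _ cancel ⟩
      0# ∎
      where
      r = rank N
      Sᵢ = insertAt S′ i inside
      Cₒ = insertAt C′ i outside
      h = whitneyTerm N Sᵢ Cₒ
      cancel : ∀ X → h (insertAt X i inside) + h (insertAt X i outside) ≈ 0#
      cancel X = begin
        sgn (insertAt X i inside) * t^ (r (Sᵢ ∪ Cₒ) ∸ r (insertAt X i inside ∪ Cₒ))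
          + sgn (insertAt X i outside) * t^ (r (Sᵢ ∪ Cₒ) ∸ r (insertAt X i outside ∪ Cₒ))
          ≈⟨ +-cong (*-cong (sgn-insertAt-inside X i) (reflexive (≡.cong (λ k → t^ (r (Sᵢ ∪ Cₒ) ∸ k)) (insertAt-spanned N C′ i loop X))))
                    (*-congʳ (reflexive (sgn-insertAt-outside X i))) ⟩
        - sgn X * q + sgn X * q ≈⟨ distribʳ q (- sgn X) (sgn X) ⟨
        (- sgn X + sgn X) * q   ≈⟨ *-congʳ (-‿inverseˡ _) ⟩
        0# * q                  ≈⟨ zeroˡ q ⟩
        0# ∎
        where q = t^ (r (Sᵢ ∪ Cₒ) ∸ r (insertAt X i outside ∪ Cₒ))

  whitney-deleteContract : ∀ {n} (N : Matroid (suc n)) {S C} x → x ∈ S → x ∉ C →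
    whitney N S C ≈ t^ (rank N (S ∪ C) ∸ rank N ((S [ x ]≔ outside) ∪ C)) * whitney N (S [ x ]≔ outside) C
                    - whitney N (S [ x ]≔ outside) (C [ x ]≔ inside)
  whitney-deleteContract N {S} {C} x x∈S x∉C =
    whitney-insertAt-deleteContract N (removeAt S x) (removeAt C x) x
      (≡.trans (insertAt-removeAt-≔ S x inside) (x∈p⇒p[x]≔inside≡p x∈S))
      (insertAt-removeAt-≔ S x outside)
      (≡.trans (insertAt-removeAt-≔ C x outside) (x∉p⇒p[x]≔outside≡p x∉C))
      (insertAt-removeAt-≔ C x inside)

  whitney-loop : ∀ {n} (N : Matroid (suc n)) {S C} x → x ∈ S → x ∉ C →
    rank N (C ∪ ⁅ x ⁆) ≡ rank N C → whitney N S C ≈ 0#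
  whitney-loop N {S} {C} x x∈S x∉C loop =
    whitney-insertAt-loop N (removeAt S x) (removeAt C x) x
      (≡.trans (insertAt-removeAt-≔ S x inside) (x∈p⇒p[x]≔inside≡p x∈S))
      C-eq
      (≡.trans (≡.cong (rank N) (≡.sym (insertAt-∪⁅⁆ (removeAt C x) x)))
               (≡.trans (≡.cong (λ A → rank N (A ∪ ⁅ x ⁆)) C-eq) (≡.trans loop (≡.cong (rank N) (≡.sym C-eq)))))
    where
    C-eq : insertAt (removeAt C x) x outside ≡ C
    C-eq = ≡.trans (insertAt-removeAt-≔ C x outside) (x∉p⇒p[x]≔outside≡p x∉C)

module WhitneyExpansion {c ℓ ℓ′} (R : OrderedCommRing c ℓ ℓ′) (t : OrderedCommRing.Carrier R) where
  open OrderedCommRing R hiding (zero)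
  open Whitney R t
  open IntegerEmbedding R
  open import Relation.Binary.Reasoning.Setoid setoid

  private
    module ℤ↦R = SubsetSumHomomorphism ℤP.+-0-commutativeMonoid +-commutativeMonoid
                   (fromℤ R) (λ a≡b → reflexive (≡.cong (fromℤ R) a≡b)) fromℤ-+

    fromℤ-when : ∀ {p} {P : Set p} (P? : Dec P) a → fromℤ R (ℤSum.when P? a) ≈ when P? (fromℤ R a)
    fromℤ-when (yes _) a = refl
    fromℤ-when (no _)  a = refl

    when-*ʳ : ∀ {p} {P : Set p} (P? : Dec P) a b → when P? a * b ≈ when P? (a * b)
    when-*ʳ (yes _) a b = refl
    when-*ʳ (no _)  a b = zeroˡ b

    sumR≡sumList : ∀ xs → sumR R xs ≡ sumList xs
    sumR≡sumList []       = ≡.refl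
    sumR≡sumList (x ∷ xs) = ≡.cong (λ z → x + z) (sumR≡sumList xs)

  möbius-sum≈whitney : ∀ {n} (M : Matroid n) →
    sumR R (map (λ F → fromℤ R (möbius M F) * pow R t (rank M ⊤ ∸ rank M F)) (flats M)) ≈ whitney M ⊤ ⊥
  möbius-sum≈whitney {n} M = begin
    sumR R (map φ (flats M))                              ≡⟨ sumR≡sumList (map φ (flats M)) ⟩
    sumList (map φ (filter (flat? M) (allSubsets n)))     ≈⟨ sumList-filter (flat? M) φ (allSubsets n) ⟩
    sumList (map (λ F → when (flat? M F) (φ F)) (allSubsets n)) ≈⟨ sumList-allSubsets n _ ⟩
    ∑⊆ ⊤ (λ F → when (flat? M F) (φ F))
      ≈⟨ ∑⊆-cong (⊤ {n}) (λ F _ → when-cong (flat? M F) (expand F)) ⟩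
    ∑⊆ ⊤ (λ F → when (flat? M F) (∑⊆ ⊤ (λ X → when (closure X ≟ˢ F) (sgn X * t^ (r ⊤ ∸ r F)))))
      ≈⟨ ∑⊆-fibres (flat? M) closure closure-isFlat (λ X F → sgn X * t^ (r ⊤ ∸ r F)) ⟩
    ∑⊆ ⊤ (λ X → sgn X * t^ (r ⊤ ∸ r (closure X)))
      ≈⟨ ∑⊆-cong (⊤ {n}) (λ X _ → *-congˡ (reflexive (≡.cong₂ (λ A B → t^ (r A ∸ B))
           (≡.sym (∪-identityʳ ⊤)) (≡.trans (rank-closure X) (≡.cong r (≡.sym (∪-identityʳ X))))))) ⟩
    whitney M ⊤ ⊥ ∎
    where
    open MatroidProperties M
    open Crosscut M
    r = rank M
    φ : Subset n → Carrier
    φ F = fromℤ R (möbius M F) * t^ (r ⊤ ∸ r F)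
    expand : ∀ F → IsFlat M F → φ F ≈ ∑⊆ ⊤ (λ X → when (closure X ≟ˢ F) (sgn X * t^ (r ⊤ ∸ r F)))
    expand F F-flat = begin
      fromℤ R (möbius M F) * t^ e           ≡⟨ ≡.cong (λ a → fromℤ R a * t^ e) (möbius≡crosscut F F-flat) ⟩
      fromℤ R (crosscut F) * t^ e           ≈⟨ *-congʳ (ℤ↦R.∑⊆-hom (⊤ {n}) _) ⟩
      ∑⊆ ⊤ (λ X → fromℤ R (ℤSum.when (closure X ≟ˢ F) (sgnℤ X))) * t^ e
        ≈⟨ *-congʳ (∑⊆-cong (⊤ {n}) (λ X _ → trans (fromℤ-when (closure X ≟ˢ F) (sgnℤ X))
                                                   (when-cong (closure X ≟ˢ F) (λ _ → fromℤ-sgnℤ X)))) ⟩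
      ∑⊆ ⊤ (λ X → when (closure X ≟ˢ F) (sgn X)) * t^ e ≈⟨ ∑⊆-*ʳ (⊤ {n}) (t^ e) _ ⟨
      ∑⊆ ⊤ (λ X → when (closure X ≟ˢ F) (sgn X) * t^ e)
        ≈⟨ ∑⊆-cong (⊤ {n}) (λ X _ → when-*ʳ (closure X ≟ˢ F) (sgn X) (t^ e)) ⟩
      ∑⊆ ⊤ (λ X → when (closure X ≟ˢ F) (sgn X * t^ e)) ∎
      where e = r ⊤ ∸ r F

-- Positivity

module Positivity {p c ℓ ℓ′} (𝓜 : Family p) (f : ℕ) (𝓜-minorClosed : MinorClosed 𝓜)
  (𝓜-bounded : BoundedCocircuit 𝓜 f) (R : OrderedCommRing c ℓ ℓ′)
  (t : OrderedCommRing.Carrier R) (f<t : OrderedCommRing._<ᴿ_ R (fromℕ R f) t) where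

  open OrderedCommRing R hiding (zero)
  open OrderedCommRingProperties R
  open Whitney R t
  open import Algebra.Properties.Ring ring using (-0#≈0#; -1*x≈-x; -‿+-comm)
  open import Relation.Binary.Reasoning.StrictPartialOrder strictPartialOrder

  Disjoint : ∀ {n} → Subset n → Subset n → Set
  Disjoint S C = ∀ {x} → x ∈ S → x ∉ C

  LooplessOver : ∀ {n} → Matroid n → Subset n → Subset n → Set
  LooplessOver N S C = ∀ x → x ∈ S → rank N C < rank N (C ∪ ⁅ x ⁆)

  WhitneySign : ∀ {n} → Matroid n → Subset n → Subset n → Set _
  WhitneySign N S C = (0# ≤ᴿ whitney N S C) × (LooplessOver N S C → 0# <ᴿ whitney N S C)

  WhitneySigns : ∀ {n} → Matroid n → Set _
  WhitneySigns N = ∀ S C → Disjoint S C → WhitneySign N S C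

  whitneySign-resp : ∀ {n} (N : Matroid n) {S C a} → a ≈ whitney N S C →
    (0# ≤ᴿ a) × (LooplessOver N S C → 0# <ᴿ a) → WhitneySign N S C
  whitneySign-resp N {S} {C} {a} a≈w (0≤a , 0<a) =
    (begin 0# ≤⟨ 0≤a ⟩ a ≈⟨ a≈w ⟩ whitney N S C ∎) ,
    λ loopless → begin-strict 0# <⟨ 0<a loopless ⟩ a ≈⟨ a≈w ⟩ whitney N S C ∎

  0<1 : 0# <ᴿ 1#
  0<1 = x<y⇒0<1 f<t

  whitneySigns-empty : (N : Matroid 0) → WhitneySigns N
  whitneySigns-empty N [] [] _ = inj₁ 0<w , λ _ → 0<w
    where
    0<w : 0# <ᴿ whitney N [] []
    0<w = begin-strict
      0#                          <⟨ 0<1 ⟩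
      1#                          ≈⟨ *-identityˡ 1# ⟨
      1# * 1#                     ≡⟨ ≡.cong (λ k → 1# * t^ k) (ℕP.n∸n≡0 (rank N ([] ∪ []))) ⟨
      whitney N [] [] ∎

  module Step {n : ℕ} (ih : (N′ : Matroid n) → 𝓜 N′ → WhitneySigns N′)
              (N : Matroid (suc n)) (N∈𝓜 : 𝓜 N) where
    private
      r = rank N
    open MatroidProperties N

    transfer : ∀ {S C} (N′ : Matroid n) i b (S′ C′ : Subset n) k → WhitneySigns N′ →
      insertAt S′ i outside ≡ S → insertAt C′ i b ≡ C → whitney N′ S′ C′ ≈ whitney N S C →
      (∀ X → r (insertAt X i b) ≡ rank N′ X ℕ.+ k) →
      Disjoint S C → WhitneySign N S C
    transfer {S} {C} N′ i b S′ C′ k signs ≡.refl ≡.refl w≈w ranks disjoint =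
      whitneySign-resp N w≈w (0≤w , λ loopless → 0<w (loopless′ loopless))
      where
      disjoint′ : Disjoint S′ C′
      disjoint′ y∈S′ y∈C′ = disjoint (x∈p⇒punchIn∈insertAt i outside y∈S′) (x∈p⇒punchIn∈insertAt i b y∈C′)
      0≤w = proj₁ (signs S′ C′ disjoint′)
      0<w = proj₂ (signs S′ C′ disjoint′)
      loopless′ : LooplessOver N S C → LooplessOver N′ S′ C′
      loopless′ loopless y y∈S′ = ℕP.+-cancelʳ-< k _ _ (≡.subst₂ _<_ (ranks C′)
        (≡.trans (≡.cong r (insertAt-∪⁅punchIn⁆ C′ i b y)) (ranks (C′ ∪ ⁅ y ⁆)))
        (loopless (punchIn i y) (x∈p⇒punchIn∈insertAt i outside y∈S′)))

    viaDeletion : ∀ {S C} i → i ∉ S → i ∉ C → Disjoint S C → WhitneySign N S C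
    viaDeletion {S} {C} i i∉S i∉C = transfer (deletion N i) i outside (removeAt S i) (removeAt C i) 0
      (ih (deletion N i) (proj₁ 𝓜-minorClosed N i (deletion N i) N∈𝓜 (deletion-isDeletion N i))) S≡ C≡
      (≡.subst₂ (λ A B → whitney (deletion N i) (removeAt S i) (removeAt C i) ≈ whitney N A B) S≡ C≡
        (whitney-deletion N i (deletion N i) (deletion-isDeletion N i) (removeAt S i) (removeAt C i)))
      (λ X → ≡.sym (ℕP.+-identityʳ _))
      where
      S≡ = ≡.trans (insertAt-removeAt-≔ S i outside) (x∉p⇒p[x]≔outside≡p i∉S)
      C≡ = ≡.trans (insertAt-removeAt-≔ C i outside) (x∉p⇒p[x]≔outside≡p i∉C)

    viaContraction : ∀ {S C} i → i ∈ C → Disjoint S C → WhitneySign N S C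
    viaContraction {S} {C} i i∈C disjoint = transfer (contraction N i) i inside (removeAt S i) (removeAt C i) (r ⁅ i ⁆)
      (ih (contraction N i) (proj₂ 𝓜-minorClosed N i (contraction N i) N∈𝓜 (contraction-isContraction N i))) S≡ C≡
      (≡.subst₂ (λ A B → whitney (contraction N i) (removeAt S i) (removeAt C i) ≈ whitney N A B) S≡ C≡
        (whitney-contraction N i (contraction N i) (contraction-isContraction N i) (removeAt S i) (removeAt C i)))
      (λ X → ≡.sym (contraction-isContraction N i X)) disjoint
      where
      S≡ = ≡.trans (insertAt-removeAt-≔ S i outside) (x∉p⇒p[x]≔outside≡p (λ i∈S → disjoint i∈S i∈C))
      C≡ = ≡.trans (insertAt-removeAt-≔ C i inside) (x∈p⇒p[x]≔inside≡p i∈C)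

    module Hyperplane (H : Subset (suc n)) (H-flat : IsFlat N H) (rank-H : r H ℕ.+ 1 ≡ r ⊤) where

      spanning : ∀ {A} x → H ⊆ A → x ∈ A → x ∉ H → r A ≡ r ⊤
      spanning {A} x H⊆A x∈A x∉H = ℕP.≤-antisym (r-mono N ⊆⊤)
        (ℕP.≤-trans (ℕP.≤-reflexive (≡.trans (≡.sym rank-H) (ℕP.+-comm (r H) 1)))
          (ℕP.≤-trans (H-flat x x∉H) (r-mono N (∪-least H⊆A (⁅x⁆⊆p x∈A)))))

      W = whitney N H ⊥

      whitney-⁅x⁆≈whitney-⊥ : ∀ x → x ∉ H → whitney N H ⁅ x ⁆ ≈ W
      whitney-⁅x⁆≈whitney-⊥ x x∉H = ∑⊆-cong H (λ X X⊆H → *-congˡ (reflexive (≡.cong t^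
        (≡.trans (≡.cong₂ _∸_ (unspanned-antitone x ⊆-refl (H-flat x x∉H))
                              (unspanned-antitone x X⊆H (H-flat x x∉H)))
                 (≡.cong₂ _∸_ (≡.cong r (≡.sym (∪-identityʳ H))) (≡.cong r (≡.sym (∪-identityʳ X))))))))

      whitney-⁅x⁆-≤ : ∀ k {T} x → H ⊆ T → x ∉ T → ∣ T ∣ ≡ ∣ H ∣ ℕ.+ k → whitney N T ⁅ x ⁆ ≤ᴿ W
      whitney-⁅x⁆-≤ zero {T} x H⊆T x∉T ∣T∣ = inj₂ (≡.subst (λ A → whitney N A ⁅ x ⁆ ≈ W) H≡T
        (whitney-⁅x⁆≈whitney-⊥ x (λ x∈H → x∉T (H⊆T x∈H))))
        where
        H≡T = p⊆q∧∣q∣≤∣p∣⇒p≡q H T H⊆T (ℕP.≤-reflexive (≡.trans ∣T∣ (ℕP.+-identityʳ _)))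
      whitney-⁅x⁆-≤ (suc k) {T} x H⊆T x∉T ∣T∣ = begin
        whitney N T ⁅ x ⁆
          ≈⟨ whitney-deleteContract N y y∈T (λ y∈⁅x⁆ → x∉T (≡.subst (_∈ T) (x∈⁅y⁆⇒x≡y x y∈⁅x⁆) y∈T)) ⟩
        t^ (r (T ∪ ⁅ x ⁆) ∸ r (T′ ∪ ⁅ x ⁆)) * whitney N T′ ⁅ x ⁆ - whitney N T′ (⁅ x ⁆ [ y ]≔ inside)
          ≈⟨ +-congʳ (trans (*-congʳ (reflexive (≡.cong t^ no-rank-drop))) (*-identityˡ _)) ⟩
        whitney N T′ ⁅ x ⁆ - whitney N T′ (⁅ x ⁆ [ y ]≔ inside)
          ≤⟨ 0≤y⇒x-y≤x (proj₁ (viaContraction x x∈⁅x⁆[y]≔inside disjoint)) ⟩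
        whitney N T′ ⁅ x ⁆
          ≤⟨ whitney-⁅x⁆-≤ k x H⊆S-x (λ x∈T′ → x∉T (p[x]≔outside⊆p T y x∈T′)) ∣S-x∣ ⟩
        W ∎
        where
        open ExtraElement (extraElement k H⊆T ∣T∣) renaming (x to y; x∈S to y∈T; x∉H to y∉H)
        T′ = T [ y ]≔ outside
        x∉H : x ∉ H
        x∉H x∈H = x∉T (H⊆T x∈H)
        no-rank-drop : r (T ∪ ⁅ x ⁆) ∸ r (T′ ∪ ⁅ x ⁆) ≡ 0
        no-rank-drop = ≡.trans
          (≡.cong₂ _∸_ (spanning x (λ z∈H → p⊆p∪q ⁅ x ⁆ (H⊆T z∈H)) (q⊆p∪q T ⁅ x ⁆ (x∈⁅x⁆ x)) x∉H)
                       (spanning x (λ z∈H → p⊆p∪q ⁅ x ⁆ (H⊆S-x z∈H)) (q⊆p∪q T′ ⁅ x ⁆ (x∈⁅x⁆ x)) x∉H))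
          (ℕP.n∸n≡0 (r ⊤))
        x∈⁅x⁆[y]≔inside : x ∈ ⁅ x ⁆ [ y ]≔ inside
        x∈⁅x⁆[y]≔inside = y∈p⇒y∈p[x]≔b ⁅ x ⁆ inside (λ x≡y → x∉T (≡.subst (_∈ T) (≡.sym x≡y) y∈T)) (x∈⁅x⁆ x)
        disjoint : Disjoint T′ (⁅ x ⁆ [ y ]≔ inside)
        disjoint {z} z∈T′ z∈ with z FinP.≟ y
        ... | yes ≡.refl = x∉p[x]≔outside T z z∈T′
        ... | no  z≢y    = x∉T (≡.subst (_∈ T) (x∈⁅y⁆⇒x≡y x (y∈p[x]≔b⇒y∈p ⁅ x ⁆ inside z≢y z∈))
                                           (p[x]≔outside⊆p T y z∈T′))

      [t-a]W-W≈[t-[1+a]]W : ∀ a → (t - a) * W - W ≈ (t - (1# + a)) * W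
      [t-a]W-W≈[t-[1+a]]W a = begin-equality
        (t - a) * W - W             ≈⟨ +-congˡ (-1*x≈-x W) ⟨
        (t - a) * W + - 1# * W      ≈⟨ distribʳ W (t - a) (- 1#) ⟨
        ((t - a) + - 1#) * W        ≈⟨ *-congʳ (+-assoc t (- a) (- 1#)) ⟩
        (t + (- a + - 1#)) * W      ≈⟨ *-congʳ (+-congˡ (-‿+-comm a 1#)) ⟩
        (t - (a + 1#)) * W          ≈⟨ *-congʳ (+-congˡ (-‿cong (+-comm a 1#))) ⟩
        (t - (1# + a)) * W ∎

      whitney-⊥-≥ : ∀ k {S} → H ⊆ S → ∣ S ∣ ≡ ∣ H ∣ ℕ.+ suc k →
                    (t - fromℕ R (suc k)) * W ≤ᴿ whitney N S ⊥
      leading : ∀ k {S} (e : ExtraElement H S k) → let open ExtraElement e in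
        (t - fromℕ R k) * W ≤ᴿ t^ (r (S ∪ ⊥) ∸ r ((S [ x ]≔ outside) ∪ ⊥)) * whitney N (S [ x ]≔ outside) ⊥

      whitney-⊥-≥ k {S} H⊆S ∣S∣ = begin
        (t - fromℕ R (suc k)) * W                         ≈⟨ [t-a]W-W≈[t-[1+a]]W (fromℕ R k) ⟨
        (t - fromℕ R k) * W - W                           ≤⟨ x≤y∧u≤v⇒x-v≤y-u (leading k e) K≤W ⟩
        t^ (r (S ∪ ⊥) ∸ r (S′ ∪ ⊥)) * whitney N S′ ⊥ - whitney N S′ (⊥ [ x ]≔ inside)
                                                          ≈⟨ whitney-deleteContract N x x∈S ∉⊥ ⟨
        whitney N S ⊥ ∎
        where
        e = extraElement k H⊆S ∣S∣
        open ExtraElement e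
        S′ = S [ x ]≔ outside
        K≤W : whitney N S′ (⊥ [ x ]≔ inside) ≤ᴿ W
        K≤W = ≡.subst (λ A → whitney N S′ A ≤ᴿ W) (≡.sym (⊥[x]≔inside≡⁅x⁆ x))
                      (whitney-⁅x⁆-≤ k x H⊆S-x (x∉p[x]≔outside S x) ∣S-x∣)

      leading zero {S} e = inj₂ (begin-equality
        (t - 0#) * W                              ≈⟨ *-congʳ (trans (+-congˡ -0#≈0#) (+-identityʳ t)) ⟩
        t * W                                     ≈⟨ *-congʳ (*-identityʳ t) ⟨
        t^ 1 * W                                  ≡⟨ ≡.cong₂ (λ k A → t^ k * whitney N A ⊥) rank-drop (≡.sym H≡S′) ⟨
        t^ (r (S ∪ ⊥) ∸ r (S′ ∪ ⊥)) * whitney N S′ ⊥ ∎)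
        where
        open ExtraElement e
        S′ = S [ x ]≔ outside
        H≡S′ : H ≡ S′
        H≡S′ = p⊆q∧∣q∣≤∣p∣⇒p≡q H S′ H⊆S-x (ℕP.≤-reflexive (≡.trans ∣S-x∣ (ℕP.+-identityʳ _)))
        rank-drop : r (S ∪ ⊥) ∸ r (S′ ∪ ⊥) ≡ 1
        rank-drop = ≡.trans
          (≡.cong₂ _∸_ (≡.trans (≡.cong r (∪-identityʳ S)) (≡.trans (spanning x (λ z∈H → p[x]≔outside⊆p S x (H⊆S-x z∈H)) x∈S x∉H) (≡.sym rank-H)))
                       (≡.cong r (≡.trans (∪-identityʳ S′) (≡.sym H≡S′))))
          (ℕP.m+n∸m≡n (r H) 1)
      leading (suc k) {S} e = begin
        (t - fromℕ R (suc k)) * W                    ≤⟨ whitney-⊥-≥ k H⊆S-x ∣S-x∣ ⟩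
        whitney N S′ ⊥                               ≈⟨ *-identityˡ _ ⟨
        t^ 0 * whitney N S′ ⊥                        ≡⟨ ≡.cong (λ k → t^ k * whitney N S′ ⊥) no-rank-drop ⟨
        t^ (r (S ∪ ⊥) ∸ r (S′ ∪ ⊥)) * whitney N S′ ⊥ ∎
        where
        open ExtraElement e
        S′ = S [ x ]≔ outside
        x′ = ExtraElement.x (extraElement k H⊆S-x ∣S-x∣)
        no-rank-drop : r (S ∪ ⊥) ∸ r (S′ ∪ ⊥) ≡ 0
        no-rank-drop = ≡.trans
          (≡.cong₂ _∸_ (≡.trans (≡.cong r (∪-identityʳ S)) (spanning x (λ z∈H → p[x]≔outside⊆p S x (H⊆S-x z∈H)) x∈S x∉H))
                       (≡.trans (≡.cong r (∪-identityʳ S′)) (spanning x′ H⊆S-x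
                          (ExtraElement.x∈S (extraElement k H⊆S-x ∣S-x∣)) (ExtraElement.x∉H (extraElement k H⊆S-x ∣S-x∣)))))
          (ℕP.n∸n≡0 (r ⊤))

    loopless⇒LooplessOver-⊥ : (∀ e → r ⁅ e ⁆ ≡ 1) → ∀ S → LooplessOver N S ⊥
    loopless⇒LooplessOver-⊥ r≡1 S x _ = ≡.subst₂ _<_ (≡.sym rank-⊥)
      (≡.trans (≡.sym (r≡1 x)) (≡.cong r (≡.sym (∪-identityˡ ⁅ x ⁆)))) (s≤s z≤n)

    rank-pair≡1 : (∀ e → r ⁅ e ⁆ ≡ 1) → ∀ e e′ → r (⁅ e ⁆ ∪ ⁅ e′ ⁆) ≢ 2 → r (⁅ e ⁆ ∪ ⁅ e′ ⁆) ≡ 1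
    rank-pair≡1 r≡1 e e′ ≢2 = ℕP.≤-antisym (ℕP.≤-pred (ℕP.≤∧≢⇒< ≤2 ≢2))
      (≡.subst (_≤ r (⁅ e ⁆ ∪ ⁅ e′ ⁆)) (r≡1 e) (r-mono N (p⊆p∪q ⁅ e′ ⁆)))
      where
      ≤2 : r (⁅ e ⁆ ∪ ⁅ e′ ⁆) ≤ 2
      ≤2 = ℕP.≤-trans (ℕP.m≤m+n _ _)
             (ℕP.≤-trans (r-submod N ⁅ e ⁆ ⁅ e′ ⁆) (ℕP.≤-reflexive (≡.cong₂ ℕ._+_ (r≡1 e) (r≡1 e′))))

    -- if e′ is parallel to e, deleting e does not change χ: in N / e, e′ is a loop
    positive-parallel : (∀ e → r ⁅ e ⁆ ≡ 1) → ∀ e e′ → e ≢ e′ → r (⁅ e ⁆ ∪ ⁅ e′ ⁆) ≡ 1 →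
                        0# <ᴿ whitney N ⊤ ⊥
    positive-parallel r≡1 e e′ e≢e′ parallel = begin-strict
      0#                 <⟨ proj₂ (viaDeletion e (x∉p[x]≔outside ⊤ e) ∉⊥ (λ _ → ∉⊥))
                                  (loopless⇒LooplessOver-⊥ r≡1 T) ⟩
      whitney N T ⊥      ≈⟨ trans (+-congˡ -0#≈0#) (+-identityʳ _) ⟨
      whitney N T ⊥ - 0# ≈⟨ +-cong (trans (*-congʳ (reflexive (≡.cong t^ no-rank-drop))) (*-identityˡ _))
                                   (-‿cong e′-loop) ⟨
      t^ (r (⊤ ∪ ⊥) ∸ r (T ∪ ⊥)) * whitney N T ⊥ - whitney N T (⊥ [ e ]≔ inside)
                         ≈⟨ whitney-deleteContract N e ∈⊤ ∉⊥ ⟨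
      whitney N ⊤ ⊥ ∎
      where
      T = ⊤ [ e ]≔ outside
      e′≢e : e′ ≢ e
      e′≢e e′≡e = e≢e′ (≡.sym e′≡e)
      e′∈T : e′ ∈ T
      e′∈T = y∈p⇒y∈p[x]≔b ⊤ outside e′≢e ∈⊤
      e′-loop : whitney N T (⊥ [ e ]≔ inside) ≈ 0#
      e′-loop = whitney-loop N e′ e′∈T
        (λ e′∈ → e′≢e (x∈⁅y⁆⇒x≡y e (≡.subst (e′ ∈_) (⊥[x]≔inside≡⁅x⁆ e) e′∈)))
        (≡.subst (λ A → r (A ∪ ⁅ e′ ⁆) ≡ r A) (≡.sym (⊥[x]≔inside≡⁅x⁆ e)) (≡.trans parallel (≡.sym (r≡1 e))))
      no-rank-drop : r (⊤ ∪ ⊥) ∸ r (T ∪ ⊥) ≡ 0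
      no-rank-drop = ≡.trans (≡.cong₂ _∸_
        (≡.cong r (≡.trans (∪-identityʳ ⊤) (≡.sym (≡.trans (p[x]≔outside∪⁅x⁆ ⊤ e) (x∈p⇒p[x]≔inside≡p ∈⊤)))))
        (≡.cong r (∪-identityʳ T)))
        (≡.trans (≡.cong (_∸ r T) (spanned-mono e (⁅x⁆⊆p e′∈T)
                   (≡.trans (≡.cong r (∪-comm ⁅ e′ ⁆ ⁅ e ⁆)) (≡.trans parallel (≡.sym (r≡1 e′))))))
                 (ℕP.n∸n≡0 (r T)))

    positive-simple : Simple N → 0# <ᴿ whitney N ⊤ ⊥
    positive-simple simple@(r≡1 , _) with 𝓜-bounded N N∈𝓜 simple
    ... | C , (H , (H-flat , rank-H) , C≡∁H) , ∣C∣≤f = begin-strict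
      0#                         <⟨ *-pos (x<y⇒0<y-x m<t) 0<W ⟩
      (t - fromℕ R (suc k)) * W  ≤⟨ whitney-⊥-≥ k ⊆⊤ ∣⊤∣ ⟩
      whitney N ⊤ ⊥ ∎
      where
      open Hyperplane H H-flat rank-H
      H≢⊤ : H ≢ ⊤
      H≢⊤ H≡⊤ = ℕP.1+n≢n (≡.trans (ℕP.+-comm 1 (r H)) (≡.trans rank-H (≡.cong r (≡.sym H≡⊤))))
      i = proj₁ (p≢⊤⇒∃∉ H H≢⊤)
      i∉H = proj₂ (p≢⊤⇒∃∉ H H≢⊤)
      k = ∣ ∁ H [ i ]≔ outside ∣
      ∣∁H∣ : ∣ ∁ H ∣ ≡ suc k
      ∣∁H∣ = ∣p∣≡1+∣p[x]≔outside∣ (x∉p⇒x∈∁p i∉H)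
      ∣⊤∣ : ∣ ⊤ {suc n} ∣ ≡ ∣ H ∣ ℕ.+ suc k
      ∣⊤∣ = ≡.trans (∣⊤∣≡n (suc n)) (≡.trans (≡.sym (∣p∣+∣∁p∣≡n H)) (≡.cong (∣ H ∣ ℕ.+_) ∣∁H∣))
      0<W : 0# <ᴿ W
      0<W = proj₂ (viaDeletion i i∉H ∉⊥ (λ _ → ∉⊥)) (loopless⇒LooplessOver-⊥ r≡1 H)
      m<t : fromℕ R (suc k) <ᴿ t
      m<t = begin-strict
        fromℕ R (suc k) ≤⟨ fromℕ-mono-≤ 0<1 (≡.subst (_≤ f) (≡.trans (≡.cong ∣_∣ C≡∁H) ∣∁H∣) ∣C∣≤f) ⟩
        fromℕ R f       <⟨ f<t ⟩
        t ∎

    positive-loopless : (∀ e → r ⁅ e ⁆ ≡ 1) → 0# <ᴿ whitney N ⊤ ⊥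
    positive-loopless r≡1
      with FinP.any? (λ e → FinP.any? (λ e′ → ¬? (e FinP.≟ e′) ×-dec ¬? (r (⁅ e ⁆ ∪ ⁅ e′ ⁆) ℕ.≟ 2)))
    ... | yes (e , e′ , e≢e′ , ≢2) = positive-parallel r≡1 e e′ e≢e′ (rank-pair≡1 r≡1 e e′ ≢2)
    ... | no  no-parallel-pair    = positive-simple (r≡1 , λ e e′ e≢e′ →
      decidable-stable (r (⁅ e ⁆ ∪ ⁅ e′ ⁆) ℕ.≟ 2) (λ ≢2 → no-parallel-pair (e , e′ , e≢e′ , ≢2)))

    whitneySign-⊤-⊥ : WhitneySign N ⊤ ⊥
    whitneySign-⊤-⊥ with FinP.any? (λ e → r ⁅ e ⁆ ℕ.≟ 0)
    ... | yes (e , loop) = inj₂ (sym w≈0) , λ loopless → ⊥-elim (ℕP.<-irrefl ≡.refl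
      (≡.subst₂ _<_ rank-⊥ (≡.trans (≡.cong r (∪-identityˡ ⁅ e ⁆)) loop) (loopless e ∈⊤)))
      where
      w≈0 : whitney N ⊤ ⊥ ≈ 0#
      w≈0 = whitney-loop N e ∈⊤ ∉⊥ (≡.trans (≡.cong r (∪-identityˡ ⁅ e ⁆)) (≡.trans loop (≡.sym rank-⊥)))
    ... | no loopless = inj₁ 0<w , λ _ → 0<w
      where
      0<w = positive-loopless (λ e → ℕP.≤-antisym (rank-⁅⁆≤1 e) (ℕP.n≢0⇒n>0 (λ loop → loopless (e , loop))))

    whitneySigns-step : WhitneySigns N
    whitneySigns-step S C disjoint with FinP.any? (λ i → ¬? (i ∈? S) ×-dec ¬? (i ∈? C))
    ... | yes (i , i∉S , i∉C) = viaDeletion i i∉S i∉C disjoint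
    ... | no  ∄i∉S∪C with FinP.any? (λ i → i ∈? C)
    ...   | yes (i , i∈C) = viaContraction i i∈C disjoint
    ...   | no  ∄i∈C      = ≡.subst₂ (WhitneySign N) (≡.sym S≡⊤) (≡.sym C≡⊥) whitneySign-⊤-⊥
      where
      C≡⊥ : C ≡ ⊥
      C≡⊥ = ⊆-antisym (λ {x} x∈C → ⊥-elim (∄i∈C (x , x∈C))) (⊆-min C)
      S≡⊤ : S ≡ ⊤
      S≡⊤ = ⊆-antisym ⊆⊤ (λ {x} _ → decidable-stable (x ∈? S)
              (λ x∉S → ∄i∉S∪C (x , x∉S , λ x∈C → ∄i∈C (x , x∈C))))

  whitneySigns : ∀ {n} (N : Matroid n) → 𝓜 N → WhitneySigns N
  whitneySigns {zero}  N _    = whitneySigns-empty N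
  whitneySigns {suc n} N N∈𝓜 = Step.whitneySigns-step (λ N′ → whitneySigns N′) N N∈𝓜

  whitney-positive : ∀ {n} (N : Matroid n) → 𝓜 N → (∀ e → rank N ⁅ e ⁆ ≢ 0) → 0# <ᴿ whitney N ⊤ ⊥
  whitney-positive N N∈𝓜 loopless = proj₂ (whitneySigns N N∈𝓜 ⊤ ⊥ (λ _ → ∉⊥)) (λ x _ →
    ≡.subst₂ _<_ (≡.sym (MatroidProperties.rank-⊥ N)) (≡.cong (rank N) (≡.sym (∪-identityˡ ⁅ x ⁆)))
      (ℕP.n≢0⇒n>0 (loopless x)))

lemma4p3 : ∀ {p c ℓ ℓ′ : Level} (𝓜 : Family p) (f : ℕ) →
    MinorClosed 𝓜 → BoundedCocircuit 𝓜 f →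
    ∀ {n} (M : Matroid n) → 𝓜 M →
    IdenticallyZero M
    ⊎ ((R : OrderedCommRing c ℓ ℓ′) → ∀ λ′ →
         OrderedCommRing._<ᴿ_ R (fromℕ R f) λ′ →
         OrderedCommRing._<ᴿ_ R (OrderedCommRing.0# R) (χ R M λ′))
lemma4p3 𝓜 f minorClosed bounded M M∈𝓜 with hasLoop? M
... | yes _        = inj₁ (λ _ → ≡.refl)
... | no  loopless = inj₂ λ R t f<t →
  let open OrderedCommRing R using (sym; isStrictTotalOrder)
      open IsStrictTotalOrder isStrictTotalOrder using (<-respʳ-≈)
  -- here χ R M t unfolds to the Möbius sum over the flats
  in <-respʳ-≈ (sym (WhitneyExpansion.möbius-sum≈whitney R t M))
       (Positivity.whitney-positive 𝓜 f minorClosed bounded R t f<t M M∈𝓜 (λ e loop → loopless (e , loop)))
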